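{- Let $G$ be a finite simple outerplanar graph of maximum degree $\Delta$, and let $B$ be a simple leaf block of $G$. If $\Delta \geq 5$, then $B$ contains a $(\Delta+1)$-vertex of $G$; if $\Delta \geq 6$, then $B$ contains a $\Delta$-vertex of $G$.
   Context: $G^2$ is the graph on $V(G)$ in which two distinct vertices are adjacent iff their distance in $G$ is 1 or 2. A $k$-vertex of $G$ is a vertex of degree at most 2 in $G$ whose degree in $G^2$ is at most $k$. A block is a maximal biconnected subgraph; a cutvertex is a vertex shared by two or more blocks; a leaf block is a block containing at most one cutvertex of $G$. For a biconnected outerplanar graph $B$ with an outerplanar embedding, its weak dual $T^*(B)$ is the graph whose vertices are the bounded faces of $B$, two faces being adjacent iff they share an edge; it is a tree (empty if $B$ is a single edge). A block $B$ is simple if $\mathrm{diam}(T^*(B)) \leq 2$, i.e. $T^*(B)$ is empty, a single vertex, a single edge, or a star on three or more vertices. -}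

module Defs where

open import Data.Nat using (ℕ; zero; suc; _+_; _≤_)
open import Data.Bool using (Bool; true; false; if_then_else_; _∧_; _∨_; not)
open import Data.Fin using (Fin; zero; suc; _≟_) renaming (_<_ to _<ᶠ_; _≤_ to _≤ᶠ_)
open import Data.Fin.Subset using (Subset; _∈_; _⊆_; ∣_∣)
open import Data.Product using (Σ; ∃; ∃₂; _×_; _,_)
open import Data.Sum using (_⊎_)
open import Relation.Nullary using (¬_)
open import Relation.Nullary.Decidable using (⌊_⌋)
open import Relation.Binary.PropositionalEquality using (_≡_; _≢_)
open import Function using (_∘_)

record Graph (n : ℕ) : Set where
  field
    adj    : Fin n → Fin n → Bool
    sym    : ∀ i j → adj i j ≡ adj j i
    irrefl : ∀ i → adj i i ≡ false
open Graph public

module _ {n : ℕ} (G : Graph n) where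

  E : Fin n → Fin n → Set
  E i j = adj G i j ≡ true

count : ∀ {n} → (Fin n → Bool) → ℕ
count {zero}  f = 0
count {suc n} f = (if f zero then 1 else 0) + count (f ∘ suc)

anyFin : ∀ {n} → (Fin n → Bool) → Bool
anyFin {zero}  f = false
anyFin {suc n} f = f zero ∨ anyFin (f ∘ suc)

module _ {n : ℕ} (G : Graph n) where

  deg : Fin n → ℕ
  deg v = count (adj G v)

  adj² : Fin n → Fin n → Bool
  adj² v j = not ⌊ v ≟ j ⌋ ∧ (adj G v j ∨ anyFin (λ w → adj G v w ∧ adj G w j))

  deg² : Fin n → ℕ
  deg² v = count (adj² v)

  KVertex : ℕ → Fin n → Set
  KVertex k v = deg v ≤ 2 × deg² v ≤ k

  MaxDegree : ℕ → Set
  MaxDegree Δ = (∀ v → deg v ≤ Δ) × ∃ λ v → deg v ≡ Δ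

  data Reach (P : Fin n → Set) : Fin n → Fin n → Set where
    here : ∀ {x} → P x → Reach P x x
    step : ∀ {x y z} → Reach P x y → E G y z → P z → Reach P x z

  Connected : (Fin n → Set) → Set
  Connected P = ∀ x y → P x → P y → Reach P x y

  -- S induces a (nonempty) connected subgraph without cutvertex
  -- (i.e. a biconnected subgraph in the sense of blocks; includes K1, K2)
  Biconnected : Subset n → Set
  Biconnected S =
    (∃ λ x → x ∈ S) ×
    Connected (_∈ S) ×
    (∀ v → v ∈ S → Connected (λ x → x ∈ S × x ≢ v))

  Block : Subset n → Set
  Block S = Biconnected S × (∀ T → S ⊆ T → Biconnected T → T ⊆ S)

  Cutvertex : Fin n → Set
  Cutvertex v = ∃₂ λ B₁ B₂ → Block B₁ × Block B₂ × B₁ ≢ B₂ × v ∈ B₁ × v ∈ B₂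

  LeafBlock : Subset n → Set
  LeafBlock B = Block B ×
    (∀ u v → u ∈ B → v ∈ B → Cutvertex u → Cutvertex v → u ≡ v)

  -- Outerplanar embeddings: vertices placed at distinct positions on a
  -- circle (in the cyclic order given by pos), edges drawn as straight
  -- chords, no two edges crossing.

  OuterplanarEmbedding : (Fin n → Fin n) → Set
  OuterplanarEmbedding pos =
    (∀ x y → pos x ≡ pos y → x ≡ y) ×
    (∀ a b c d → E G a b → E G c d →
       ¬ (pos a <ᶠ pos c × pos c <ᶠ pos b × pos b <ᶠ pos d))

  module _ (pos : Fin n → Fin n) (B : Subset n) where

    -- F (vertex set of a convex polygon) is a bounded face of the induced
    -- subgraph B in the drawing given by pos:
    --  * F ⊆ B, |F| ≥ 3;
    --  * cyclically consecutive vertices of F (in circle order) are adjacent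
    --    (the polygon sides are edges of B);
    --  * no edge of B meets the interior of the polygon, i.e. no edge of B
    --    has vertices of F strictly on both sides of it.
    Face : Subset n → Set
    Face F =
      F ⊆ B × 3 ≤ ∣ F ∣ ×
      (∀ f f' → f ∈ F → f' ∈ F → pos f <ᶠ pos f' →
         ((∀ g → g ∈ F → ¬ (pos f <ᶠ pos g × pos g <ᶠ pos f')) → E G f f') ×
         ((∀ g → g ∈ F → pos f ≤ᶠ pos g × pos g ≤ᶠ pos f') → E G f f')) ×
      (∀ x y → x ∈ B → y ∈ B → E G x y → pos x <ᶠ pos y →
         ¬ (∃₂ λ g g' → g ∈ F × g' ∈ F ×
              (pos x <ᶠ pos g × pos g <ᶠ pos y) ×
              (pos g' <ᶠ pos x ⊎ pos y <ᶠ pos g')))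

    FaceAdj : Subset n → Subset n → Set
    FaceAdj F₁ F₂ = ∃₂ λ x y →
      x ∈ F₁ × y ∈ F₁ × x ∈ F₂ × y ∈ F₂ × E G x y

    -- B is simple: diam(T*(B)) ≤ 2, i.e. any two bounded faces are at
    -- distance at most 2 in the weak dual
    SimpleBlock : Set
    SimpleBlock = ∀ F₁ F₂ → Face F₁ → Face F₂ →
      F₁ ≡ F₂ ⊎ FaceAdj F₁ F₂ ⊎
      (∃ λ F₃ → Face F₃ × FaceAdj F₁ F₃ × FaceAdj F₃ F₂)

module Submission where

-- Both claims are instances of one statement: for every K ≥ 6 with Δ ≤ K,
-- B contains a vertex v with deg v ≤ 2 and deg² v ≤ K.  Let c be the (at most one) cutvertex of G in B; every other
-- vertex of B has all its neighbours in B.  Read the embedding as an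
-- injective map p into ℕ (the position on the circle) and rotate it so that
-- c comes first; rotation preserves the cyclic order, hence non-crossing,
-- faces and simplicity.  In this drawing
--   * cyclically consecutive vertices of B are adjacent (boundary edges);
--   * a chord xy with vertices of B strictly between x and y bounds a face
--     on that side (the inner face), and a simple block cannot contain two
--     faces separated by a chord; hence every vertex of B other than c
--     has degree at most 4;
--   * walking along the boundary from c, a case analysis on the chords of B
--     produces a vertex of degree ≤ 2 whose neighbours have small degree;
--     the bounds  deg² v ≤ deg a + deg b  (neighbours a, b of v) and their
--     refinements then give deg² v ≤ K.
-- Since the existence of such a vertex is decidable, it suffices to refute
-- its absence, which lets the argument use minimal and maximal elements and
-- case splits on undecided propositions freely.

open import Defs
open import Data.Nat using (ℕ; zero; suc; _+_; _∸_; _≤_; _<_; z≤n; s≤s; _<?_; _≤?_)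
open import Data.Nat.Properties hiding (_≟_)
open import Data.Nat.Induction using (<-wellFounded)
open import Data.Bool using (Bool; true; false; _∧_; _∨_; not)
import Data.Bool as Bool
open import Data.Fin using (Fin; zero; suc; _≟_; toℕ)
open import Data.Fin.Properties using (any?; toℕ<n; toℕ-injective)
open import Data.Fin.Subset using (Subset; _∈_; _⊆_; ∣_∣; ⁅_⁆; _∪_)
open import Data.Fin.Subset.Properties using (_∈?_; x∈p∪q⁻; x∈p∪q⁺; x∈⁅x⁆; x∈⁅y⁆⇒x≡y; p⊂q⇒∣p∣<∣q∣; ∣p∣≤n)
open import Data.Vec using ([]; _∷_; lookup; tabulate)
open import Data.Vec.Properties using ([]=⇒lookup; lookup⇒[]=; lookup∘tabulate)
open import Data.Product using (∃; ∃₂; _×_; _,_; proj₁; proj₂)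
open import Data.Sum using (_⊎_; inj₁; inj₂)
open import Data.Empty using (⊥; ⊥-elim)
open import Relation.Nullary using (¬_; Dec; yes; no)
open import Relation.Nullary.Decidable using (⌊_⌋; _×-dec_; ¬?)
open import Relation.Binary.PropositionalEquality using (_≡_; _≢_; refl; trans; cong; subst; subst₂) renaming (sym to esym)
open import Relation.Binary.Definitions using (tri<; tri≈; tri>)
open import Function using (_∘_)
open import Induction.WellFounded using (Acc; acc)

byCases : ∀ {A : Set} → (A → ⊥) → (¬ A → ⊥) → ⊥
byCases f g = g f

true-stable : ∀ {b : Bool} → ¬ ¬ (b ≡ true) → b ≡ true
true-stable {true} _ = refl
true-stable {false} h = ⊥-elim (h (λ ()))

false-of-¬true : ∀ {b : Bool} → ¬ (b ≡ true) → b ≡ false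
false-of-¬true {true} h = ⊥-elim (h refl)
false-of-¬true {false} h = refl

withMinimalAcc : ∀ {A : Set} (P : A → Set) (f : A → ℕ) (x : A) → Acc _<_ (f x) → P x →
                 ((y : A) → P y → (∀ z → P z → f y ≤ f z) → ⊥) → ⊥
withMinimalAcc P f x (acc rs) px k =
  k' (λ { (z , pz , lt) → withMinimalAcc P f z (rs lt) pz k })
  where
  k' : ¬ (∃ λ z → P z × f z < f x) → ⊥
  k' h = k x px (λ z pz → ≮⇒≥ (λ lt → h (z , pz , lt)))

withMinimal : ∀ {A : Set} (P : A → Set) (f : A → ℕ) (x : A) → P x →
              ((y : A) → P y → (∀ z → P z → f y ≤ f z) → ⊥) → ⊥
withMinimal P f x px k = withMinimalAcc P f x (<-wellFounded (f x)) px k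

-- A bounded measure has a maximal P-element (minimise bd ∸ f).
withMaximal : ∀ {A : Set} (P : A → Set) (f : A → ℕ) (bd : ℕ) → (∀ y → P y → f y ≤ bd) →
              (x : A) → P x →
              ((y : A) → P y → (∀ z → P z → f z ≤ f y) → ⊥) → ⊥
withMaximal P f bd hb x px k =
  withMinimal P (λ y → bd ∸ f y) x px
    (λ y py mn → k y py (λ z pz → flip (hb y py) (hb z pz) (mn z pz)))
  where
  flip : ∀ {a b} → a ≤ bd → b ≤ bd → bd ∸ a ≤ bd ∸ b → b ≤ a
  flip {a} {b} ha hb' h = ≮⇒≥ (λ a<b → <⇒≱ (∸-monoʳ-< a<b hb') h)

-- Membership in a finite list of candidates is decidable, so it is stable.
stable₁ : ∀ {n} {w a : Fin n} → ¬ ¬ (w ≡ a) → w ≡ a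
stable₁ {w = w} {a} h with w ≟ a
... | yes e = e
... | no ne = ⊥-elim (h ne)

stable₂ : ∀ {n} {w a b : Fin n} → ¬ ¬ (w ≡ a ⊎ w ≡ b) → w ≡ a ⊎ w ≡ b
stable₂ {w = w} {a} {b} h with w ≟ a | w ≟ b
... | yes e | _ = inj₁ e
... | no _ | yes e = inj₂ e
... | no n1 | no n2 = ⊥-elim (h λ { (inj₁ e) → n1 e ; (inj₂ e) → n2 e })

stable₃ : ∀ {n} {w a b d : Fin n} → ¬ ¬ (w ≡ a ⊎ w ≡ b ⊎ w ≡ d) → w ≡ a ⊎ w ≡ b ⊎ w ≡ d
stable₃ {w = w} {a} {b} {d} h with w ≟ a | w ≟ b | w ≟ d
... | yes e | _ | _ = inj₁ e
... | no _ | yes e | _ = inj₂ (inj₁ e)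
... | no _ | no _ | yes e = inj₂ (inj₂ e)
... | no n1 | no n2 | no n3 = ⊥-elim (h λ { (inj₁ e) → n1 e ; (inj₂ (inj₁ e)) → n2 e ; (inj₂ (inj₂ e)) → n3 e })

∨-elim : ∀ {a b : Bool} → a ∨ b ≡ true → a ≡ true ⊎ b ≡ true
∨-elim {true} _ = inj₁ refl
∨-elim {false} h = inj₂ h

∧-elim : ∀ {a b : Bool} → a ∧ b ≡ true → a ≡ true × b ≡ true
∧-elim {true} {true} _ = refl , refl

∨-introˡ : ∀ {a} b → a ≡ true → a ∨ b ≡ true
∨-introˡ b refl = refl

∨-introʳ : ∀ a {b} → b ≡ true → a ∨ b ≡ true
∨-introʳ true refl = refl
∨-introʳ false refl = refl

∧-intro : ∀ {a b} → a ≡ true → b ≡ true → a ∧ b ≡ true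
∧-intro refl refl = refl

isEq : ∀ {n} → Fin n → Fin n → Bool
isEq i j = ⌊ i ≟ j ⌋

isEq-refl : ∀ {n} (i : Fin n) → isEq i i ≡ true
isEq-refl i with i ≟ i
... | yes _ = refl
... | no h = ⊥-elim (h refl)

isEq-≡ : ∀ {n} {i j : Fin n} → i ≡ j → isEq i j ≡ true
isEq-≡ {i = i} refl = isEq-refl i

≡-of-isEq : ∀ {n} {i j : Fin n} → isEq i j ≡ true → i ≡ j
≡-of-isEq {i = i} {j} h with i ≟ j
... | yes e = e

isEq-suc : ∀ {n} (i j : Fin n) → isEq (suc i) (suc j) ≡ isEq i j
isEq-suc i j with i ≟ j
... | yes refl = refl
... | no _ = refl

isEq-≢ : ∀ {n} {i j : Fin n} → i ≢ j → not (isEq i j) ≡ true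
isEq-≢ {i = i} {j} h with i ≟ j
... | yes e = ⊥-elim (h e)
... | no _ = refl

≢-of-isEq : ∀ {n} {i j : Fin n} → not (isEq i j) ≡ true → i ≢ j
≢-of-isEq {i = i} {j} h e with i ≟ j
... | no ne = ne e

dec-true : ∀ {P : Set} (d : Dec P) → ⌊ d ⌋ ≡ true → P
dec-true (yes p) _ = p

true-dec : ∀ {P : Set} (d : Dec P) → P → ⌊ d ⌋ ≡ true
true-dec (yes _) _ = refl
true-dec (no np) p = ⊥-elim (np p)

count-mono : ∀ {n} (f g : Fin n → Bool) → (∀ i → f i ≡ true → g i ≡ true) → count f ≤ count g
count-mono {zero} f g h = z≤n
count-mono {suc n} f g h with f zero in ef | g zero in eg
... | true | true = s≤s (count-mono (f ∘ suc) (g ∘ suc) (λ i → h (suc i)))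
... | true | false with () ← trans (esym (h zero ef)) eg
... | false | true = m≤n⇒m≤1+n (count-mono (f ∘ suc) (g ∘ suc) (λ i → h (suc i)))
... | false | false = count-mono (f ∘ suc) (g ∘ suc) (λ i → h (suc i))

count-∨ : ∀ {n} (f g : Fin n → Bool) → count (λ i → f i ∨ g i) ≤ count f + count g
count-∨ {zero} f g = z≤n
count-∨ {suc n} f g with f zero | g zero
... | true | true = s≤s (≤-trans (count-∨ (f ∘ suc) (g ∘ suc)) (+-monoʳ-≤ (count (f ∘ suc)) (n≤1+n _)))
... | true | false = s≤s (count-∨ (f ∘ suc) (g ∘ suc))
... | false | true = subst (suc (count (λ i → f (suc i) ∨ g (suc i))) ≤_)
                          (esym (+-suc (count (f ∘ suc)) (count (g ∘ suc))))
                          (s≤s (count-∨ (f ∘ suc) (g ∘ suc)))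
... | false | false = count-∨ (f ∘ suc) (g ∘ suc)

count-zero : ∀ {n} (f : Fin n → Bool) → (∀ i → f i ≡ false) → count f ≡ 0
count-zero {zero} f h = refl
count-zero {suc n} f h rewrite h zero = count-zero (f ∘ suc) (λ i → h (suc i))

count-ext : ∀ {n} (f g : Fin n → Bool) → (∀ i → f i ≡ g i) → count f ≡ count g
count-ext {zero} f g h = refl
count-ext {suc n} f g h rewrite h zero = cong (_ +_) (count-ext (f ∘ suc) (g ∘ suc) (λ i → h (suc i)))

count-single : ∀ {n} (a : Fin n) → count (λ i → isEq i a) ≡ 1
count-single {suc n} zero = cong suc (count-zero {n} (λ i → isEq (suc i) zero) (λ i → refl))
count-single {suc n} (suc a) = trans (count-ext _ _ (λ i → isEq-suc i a)) (count-single a)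

count-del : ∀ {n} (f : Fin n → Bool) (a : Fin n) → f a ≡ true →
            suc (count (λ i → f i ∧ not (isEq i a))) ≡ count f
count-del {suc n} f zero fa rewrite fa = cong suc (count-∧true (f ∘ suc))
  where
  count-∧true : ∀ {m} (g : Fin m → Bool) → count (λ i → g i ∧ true) ≡ count g
  count-∧true {zero} g = refl
  count-∧true {suc m} g with g zero
  ... | true = cong suc (count-∧true (g ∘ suc))
  ... | false = count-∧true (g ∘ suc)
count-del {suc n} f (suc a) fa with f zero
... | true = cong suc (trans (cong suc (count-ext _ _ shift)) (count-del (f ∘ suc) a fa))
  where shift = λ i → cong (λ b → f (suc i) ∧ not b) (isEq-suc i a)
... | false = trans (cong suc (count-ext _ _ shift)) (count-del (f ∘ suc) a fa)
  where shift = λ i → cong (λ b → f (suc i) ∧ not b) (isEq-suc i a)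

count≥1 : ∀ {n} (f : Fin n → Bool) a → f a ≡ true → 1 ≤ count f
count≥1 f a h = subst (1 ≤_) (count-del f a h) (s≤s z≤n)

count≤2 : ∀ {n} (f : Fin n → Bool) a b → (∀ i → f i ≡ true → i ≡ a ⊎ i ≡ b) → count f ≤ 2
count≤2 {n} f a b h =
  ≤-trans (count-mono {n} f (λ j → isEq j a ∨ isEq j b) at-a-or-b)
    (≤-trans (count-∨ {n} _ _) (subst₂ (λ x y → x + y ≤ 2) (esym (count-single a)) (esym (count-single b)) ≤-refl))
  where
  at-a-or-b : ∀ j → f j ≡ true → (isEq j a ∨ isEq j b) ≡ true
  at-a-or-b j e with h j e
  ... | inj₁ q = ∨-introˡ _ (isEq-≡ q)
  ... | inj₂ q = ∨-introʳ _ (isEq-≡ q)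

count≤3 : ∀ {n} (f : Fin n → Bool) a b d → (∀ i → f i ≡ true → i ≡ a ⊎ i ≡ b ⊎ i ≡ d) → count f ≤ 3
count≤3 {n} f a b d h =
  ≤-trans (count-mono {n} f (λ j → isEq j a ∨ (isEq j b ∨ isEq j d)) at-a-b-or-d)
    (≤-trans (count-∨ {n} _ _)
      (subst (λ x → x + count (λ j → isEq j b ∨ isEq j d) ≤ 3) (esym (count-single a))
        (s≤s (count≤2 {n} (λ j → isEq j b ∨ isEq j d) b d at-b-or-d))))
  where
  at-a-b-or-d : ∀ j → f j ≡ true → (isEq j a ∨ (isEq j b ∨ isEq j d)) ≡ true
  at-a-b-or-d j e with h j e
  ... | inj₁ q = ∨-introˡ (isEq j b ∨ isEq j d) (isEq-≡ q)
  ... | inj₂ (inj₁ q) = ∨-introʳ (isEq j a) (∨-introˡ (isEq j d) (isEq-≡ q))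
  ... | inj₂ (inj₂ q) = ∨-introʳ (isEq j a) (∨-introʳ (isEq j b) (isEq-≡ q))
  at-b-or-d : ∀ j → (isEq j b ∨ isEq j d) ≡ true → j ≡ b ⊎ j ≡ d
  at-b-or-d j e with ∨-elim {isEq j b} e
  ... | inj₁ q = inj₁ (≡-of-isEq q)
  ... | inj₂ q = inj₂ (≡-of-isEq q)

anyFin-∃ : ∀ {n} (f : Fin n → Bool) → anyFin f ≡ true → ∃ λ i → f i ≡ true
anyFin-∃ {suc n} f h with f zero in e
... | true = zero , e
... | false = let (i , p) = anyFin-∃ (f ∘ suc) h in suc i , p

∣∣-count : ∀ {n} (F : Subset n) → ∣ F ∣ ≡ count (lookup F)
∣∣-count [] = refl
∣∣-count (true ∷ F) = cong suc (∣∣-count F)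
∣∣-count (false ∷ F) = ∣∣-count F

mem→ : ∀ {n} {F : Subset n} {a} → a ∈ F → lookup F a ≡ true
mem→ = []=⇒lookup

mem← : ∀ {n} {F : Subset n} {a} → lookup F a ≡ true → a ∈ F
mem← {F = F} {a} = lookup⇒[]= a F

three≤∣∣ : ∀ {n} (F : Subset n) a b c → a ∈ F → b ∈ F → c ∈ F → a ≢ b → a ≢ c → b ≢ c → 3 ≤ ∣ F ∣
three≤∣∣ {n} F a b c aF bF cF ab ac bc =
  subst (3 ≤_) (esym (∣∣-count F))
   (subst (3 ≤_) (count-del (lookup F) a (mem→ aF))
    (s≤s (subst (2 ≤_) (count-del without-a b (∧-intro (mem→ bF) (isEq-≢ (λ e → ab (esym e)))))
      (s≤s (count≥1 without-ab c
        (∧-intro (∧-intro (mem→ cF) (isEq-≢ (λ e → ac (esym e)))) (isEq-≢ (λ e → bc (esym e)))))))))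
  where
  without-a = λ i → lookup F i ∧ not (isEq i a)
  without-ab = λ i → without-a i ∧ not (isEq i b)

∣∣≤2 : ∀ {n} (F : Subset n) a b → (∀ g → g ∈ F → g ≡ a ⊎ g ≡ b) → ∣ F ∣ ≤ 2
∣∣≤2 F a b h = subst (_≤ 2) (esym (∣∣-count F)) (count≤2 (lookup F) a b (λ i e → h i (mem← e)))

-- A position map p : Fin n → ℕ places the vertices on a
-- circle; Cyclic p u v w says that u, v, w appear in this cyclic order.
-- Rotating the circle changes the linear order but not the cyclic one.

module _ {n : ℕ} where

  Cyclic : (Fin n → ℕ) → Fin n → Fin n → Fin n → Set
  Cyclic p u v w = (p u < p v × p v < p w) ⊎ (p v < p w × p w < p u) ⊎ (p w < p u × p u < p v)

  cyclic-rotate : ∀ p {u v w} → Cyclic p u v w → Cyclic p v w u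
  cyclic-rotate p (inj₁ x) = inj₂ (inj₂ x)
  cyclic-rotate p (inj₂ (inj₁ x)) = inj₁ x
  cyclic-rotate p (inj₂ (inj₂ x)) = inj₂ (inj₁ x)

  cyclic-linear : ∀ p {u v w} → p u < p w → Cyclic p u v w → p u < p v × p v < p w
  cyclic-linear p h (inj₁ x) = x
  cyclic-linear p h (inj₂ (inj₁ (a , b))) = ⊥-elim (<-asym h b)
  cyclic-linear p h (inj₂ (inj₂ (a , b))) = ⊥-elim (<-asym h a)

  rotatePos : ℕ → ℕ → (Fin n → ℕ) → Fin n → ℕ
  rotatePos s N p v with p v <? s
  ... | yes _ = p v + N
  ... | no _ = p v

  module Rotation (s N : ℕ) (p : Fin n → ℕ) (p<N : ∀ v → p v < N) where
    p' : Fin n → ℕ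
    p' = rotatePos s N p

    data Side (v : Fin n) : Set where
      moved : p v < s → p' v ≡ p v + N → Side v
      kept  : ¬ p v < s → p' v ≡ p v → Side v

    moved-pos : ∀ v → p v < s → p' v ≡ p v + N
    moved-pos v h with p v <? s
    ... | yes _ = refl
    ... | no q = ⊥-elim (q h)

    kept-pos : ∀ v → ¬ p v < s → p' v ≡ p v
    kept-pos v h with p v <? s
    ... | yes q = ⊥-elim (h q)
    ... | no _ = refl

    side : ∀ v → Side v
    side v with p v <? s
    ... | yes h = moved h (moved-pos v h)
    ... | no h = kept h (kept-pos v h)

    moved-moved : ∀ {a b} → p' a ≡ p a + N → p' b ≡ p b + N → p a < p b → p' a < p' b
    moved-moved ea eb h rewrite ea | eb = +-monoˡ-< N h
    kept-kept : ∀ {a b} → p' a ≡ p a → p' b ≡ p b → p a < p b → p' a < p' b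
    kept-kept ea eb h rewrite ea | eb = h
    kept-moved : ∀ {a b} → p' a ≡ p a → p' b ≡ p b + N → p' a < p' b
    kept-moved {a} {b} ea eb rewrite ea | eb = <-≤-trans (p<N a) (m≤n+m N (p b))
    moved-moved⁻ : ∀ {a b} → p' a ≡ p a + N → p' b ≡ p b + N → p' a < p' b → p a < p b
    moved-moved⁻ ea eb h rewrite ea | eb = +-cancelʳ-< _ _ _ h
    kept-kept⁻ : ∀ {a b} → p' a ≡ p a → p' b ≡ p b → p' a < p' b → p a < p b
    kept-kept⁻ ea eb h rewrite ea | eb = h
    moved-kept⁻ : ∀ {a b} → p' a ≡ p a + N → p' b ≡ p b → p' a < p' b → ⊥
    moved-kept⁻ {a} {b} ea eb h rewrite ea | eb = <-irrefl refl (<-trans (<-≤-trans (p<N b) (m≤n+m N (p a))) h)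
    kept-below-moved : ∀ {a b} → p a < s → ¬ p b < s → p b < p a → ⊥
    kept-below-moved ha hb h = hb (<-trans h ha)

    linear→cyclic' : ∀ a b c → p a < p b → p b < p c → Cyclic p' a b c
    linear→cyclic' a b c ab bc with side a | side b | side c
    ... | moved ha ea | moved hb eb | moved hc ec = inj₁ (moved-moved ea eb ab , moved-moved eb ec bc)
    ... | moved ha ea | moved hb eb | kept hc ec = inj₂ (inj₂ (kept-moved ec ea , moved-moved ea eb ab))
    ... | moved ha ea | kept hb eb | moved hc ec = ⊥-elim (kept-below-moved hc hb bc)
    ... | moved ha ea | kept hb eb | kept hc ec = inj₂ (inj₁ (kept-kept eb ec bc , kept-moved ec ea))
    ... | kept ha ea | moved hb eb | _ = ⊥-elim (kept-below-moved hb ha ab)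
    ... | kept ha ea | kept hb eb | moved hc ec = ⊥-elim (kept-below-moved hc hb bc)
    ... | kept ha ea | kept hb eb | kept hc ec = inj₁ (kept-kept ea eb ab , kept-kept eb ec bc)

    linear'→cyclic : ∀ a b c → p' a < p' b → p' b < p' c → Cyclic p a b c
    linear'→cyclic a b c ab bc with side a | side b | side c
    ... | moved ha ea | moved hb eb | moved hc ec = inj₁ (moved-moved⁻ ea eb ab , moved-moved⁻ eb ec bc)
    ... | moved ha ea | moved hb eb | kept hc ec = ⊥-elim (moved-kept⁻ eb ec bc)
    ... | moved ha ea | kept hb eb | _ = ⊥-elim (moved-kept⁻ ea eb ab)
    ... | kept ha ea | moved hb eb | moved hc ec = inj₂ (inj₁ (moved-moved⁻ eb ec bc , <-≤-trans hc (≮⇒≥ ha)))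
    ... | kept ha ea | moved hb eb | kept hc ec = ⊥-elim (moved-kept⁻ eb ec bc)
    ... | kept ha ea | kept hb eb | moved hc ec = inj₂ (inj₂ (<-≤-trans hc (≮⇒≥ ha) , kept-kept⁻ ea eb ab))
    ... | kept ha ea | kept hb eb | kept hc ec = inj₁ (kept-kept⁻ ea eb ab , kept-kept⁻ eb ec bc)

    cyclic→cyclic' : ∀ {u v w} → Cyclic p u v w → Cyclic p' u v w
    cyclic→cyclic' {u} {v} {w} (inj₁ (a , b)) = linear→cyclic' u v w a b
    cyclic→cyclic' {u} {v} {w} (inj₂ (inj₁ (a , b))) = cyclic-rotate p' (cyclic-rotate p' (linear→cyclic' v w u a b))
    cyclic→cyclic' {u} {v} {w} (inj₂ (inj₂ (a , b))) = cyclic-rotate p' (linear→cyclic' w u v a b)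

    cyclic'→cyclic : ∀ {u v w} → Cyclic p' u v w → Cyclic p u v w
    cyclic'→cyclic {u} {v} {w} (inj₁ (a , b)) = linear'→cyclic u v w a b
    cyclic'→cyclic {u} {v} {w} (inj₂ (inj₁ (a , b))) = cyclic-rotate p (cyclic-rotate p (linear'→cyclic v w u a b))
    cyclic'→cyclic {u} {v} {w} (inj₂ (inj₂ (a , b))) = cyclic-rotate p (linear'→cyclic w u v a b)

    injective' : (∀ x y → p x ≡ p y → x ≡ y) → ∀ x y → p' x ≡ p' y → x ≡ y
    injective' i x y e with side x | side y
    ... | moved _ ex | moved _ ey = i x y (+-cancelʳ-≡ _ _ _ (trans (esym ex) (trans e ey)))
    ... | kept _ ex | kept _ ey = i x y (trans (esym ex) (trans e ey))
    ... | moved _ ex | kept _ ey = ⊥-elim (<-irrefl refl (<-≤-trans (p<N y)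
            (subst (N ≤_) (trans (esym ex) (trans e ey)) (m≤n+m N (p x)))))
    ... | kept _ ex | moved _ ey = ⊥-elim (<-irrefl refl (<-≤-trans (p<N x)
            (subst (N ≤_) (trans (esym ey) (trans (esym e) ex)) (m≤n+m N (p y)))))

    bounded' : ∀ v → p' v < N + N
    bounded' v with side v
    ... | moved _ e rewrite e = +-monoˡ-< N (p<N v)
    ... | kept _ e rewrite e = <-≤-trans (p<N v) (m≤m+n N N)

    start-first : ∀ c v → p c ≡ s → v ≢ c → (∀ x y → p x ≡ p y → x ≡ y) → p' c < p' v
    start-first c v ec ne i with side c | side v
    ... | moved h _ | _ = ⊥-elim (<-irrefl ec h)
    ... | kept _ e1 | moved _ e2 = kept-moved e1 e2
    ... | kept _ e1 | kept h e2 = subst₂ _<_ (esym e1) (esym e2)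
            (≤∧≢⇒< (subst (_≤ p v) (esym ec) (≮⇒≥ h)) (λ e → ne (i v c (esym e))))

-- The faces and the simplicity condition of
-- Defs are restated for an arbitrary injective p : Fin n → ℕ (for
-- p = toℕ ∘ pos they are the original ones, definitionally), and in a
-- cyclic form that makes their invariance under rotation evident.

module _ {n : ℕ} (G : Graph n) where

  E-sym : ∀ {a b} → E G a b → E G b a
  E-sym {a} {b} h = trans (Graph.sym G b a) h

  E-irrefl : ∀ {a} → E G a a → ⊥
  E-irrefl {a} h with () ← trans (esym h) (Graph.irrefl G a)

  E-≢ : ∀ {a b} → E G a b → a ≢ b
  E-≢ h refl = E-irrefl h

  Injective : (Fin n → ℕ) → Set
  Injective p = ∀ x y → p x ≡ p y → x ≡ y

  NoCross : (Fin n → ℕ) → Set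
  NoCross p = ∀ a b c d → E G a b → E G c d → ¬ (p a < p c × p c < p b × p b < p d)

  CycNoCross : (Fin n → ℕ) → Set
  CycNoCross p = ∀ a b c d → E G a b → E G c d → Cyclic p a c b → Cyclic p a b d → ⊥

  Face' : (Fin n → ℕ) → Subset n → Subset n → Set
  Face' p B F =
      F ⊆ B × 3 ≤ ∣ F ∣ ×
      (∀ f f' → f ∈ F → f' ∈ F → p f < p f' →
         ((∀ g → g ∈ F → ¬ (p f < p g × p g < p f')) → E G f f') ×
         ((∀ g → g ∈ F → p f ≤ p g × p g ≤ p f') → E G f f')) ×
      (∀ x y → x ∈ B → y ∈ B → E G x y → p x < p y →
         ¬ (∃₂ λ g g' → g ∈ F × g' ∈ F ×
              (p x < p g × p g < p y) ×
              (p g' < p x ⊎ p y < p g')))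

  CycFace : (Fin n → ℕ) → Subset n → Subset n → Set
  CycFace p B F =
      F ⊆ B × 3 ≤ ∣ F ∣ ×
      (∀ f f' → f ∈ F → f' ∈ F → f ≢ f' → (∀ g → g ∈ F → ¬ Cyclic p f g f') → E G f f') ×
      (∀ x y g g' → x ∈ B → y ∈ B → E G x y → g ∈ F → g' ∈ F → Cyclic p x g y → Cyclic p y g' x → ⊥)

  FaceAdj' : Subset n → Subset n → Set
  FaceAdj' F₁ F₂ = ∃₂ λ x y → x ∈ F₁ × y ∈ F₁ × x ∈ F₂ × y ∈ F₂ × E G x y

  Simple' : (Fin n → ℕ) → Subset n → Set
  Simple' p B = ∀ F₁ F₂ → Face' p B F₁ → Face' p B F₂ →
      F₁ ≡ F₂ ⊎ FaceAdj' F₁ F₂ ⊎ (∃ λ F₃ → Face' p B F₃ × FaceAdj' F₁ F₃ × FaceAdj' F₃ F₂)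

  noCross→cyc : ∀ p → NoCross p → CycNoCross p
  noCross→cyc p nc a b c d eab ecd (inj₁ (ac , cb)) (inj₁ (ab , bd)) = nc a b c d eab ecd (ac , cb , bd)
  noCross→cyc p nc a b c d eab ecd (inj₁ (ac , cb)) (inj₂ (inj₁ (bd , da))) = <-asym (<-trans ac cb) (<-trans bd da)
  noCross→cyc p nc a b c d eab ecd (inj₁ (ac , cb)) (inj₂ (inj₂ (da , ab))) = nc d c a b (E-sym ecd) eab (da , ac , cb)
  noCross→cyc p nc a b c d eab ecd (inj₂ (inj₁ (cb , ba))) (inj₁ (ab , bd)) = <-asym ab ba
  noCross→cyc p nc a b c d eab ecd (inj₂ (inj₁ (cb , ba))) (inj₂ (inj₁ (bd , da))) = nc c d b a ecd (E-sym eab) (cb , bd , da)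
  noCross→cyc p nc a b c d eab ecd (inj₂ (inj₁ (cb , ba))) (inj₂ (inj₂ (da , ab))) = <-asym ab ba
  noCross→cyc p nc a b c d eab ecd (inj₂ (inj₂ (ba , ac))) (inj₁ (ab , bd)) = <-asym ab ba
  noCross→cyc p nc a b c d eab ecd (inj₂ (inj₂ (ba , ac))) (inj₂ (inj₁ (bd , da))) = nc b a d c (E-sym eab) (E-sym ecd) (bd , da , ac)
  noCross→cyc p nc a b c d eab ecd (inj₂ (inj₂ (ba , ac))) (inj₂ (inj₂ (da , ab))) = <-asym ab ba

  cyc→noCross : ∀ p → CycNoCross p → NoCross p
  cyc→noCross p cnc a b c d eab ecd (ac , cb , bd) =
    cnc a b c d eab ecd (inj₁ (ac , cb)) (inj₁ (<-trans ac cb , bd))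

  face→cycFace : ∀ p B F → Injective p → Face' p B F → CycFace p B F
  face→cycFace p B F inj (sub , sz , sides , sep) = sub , sz , consecutive , separated
    where
    consecutive : ∀ f f' → f ∈ F → f' ∈ F → f ≢ f' → (∀ g → g ∈ F → ¬ Cyclic p f g f') → E G f f'
    consecutive f f' fF f'F ne h with <-cmp (p f) (p f')
    ... | tri< lt _ _ = proj₁ (sides f f' fF f'F lt) (λ g gF b → h g gF (inj₁ b))
    ... | tri≈ _ e _ = ⊥-elim (ne (inj f f' e))
    ... | tri> _ _ gt = E-sym (proj₂ (sides f' f f'F fF gt)
            (λ g gF → ≮⇒≥ (λ l → h g gF (inj₂ (inj₁ (l , gt)))) , ≮⇒≥ (λ l → h g gF (inj₂ (inj₂ (gt , l))))))
    outside : ∀ {x y g} → p x < p y → Cyclic p y g x → p g < p x ⊎ p y < p g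
    outside lt (inj₁ (a , b)) = ⊥-elim (<-asym lt (<-trans a b))
    outside lt (inj₂ (inj₁ (a , b))) = inj₁ a
    outside lt (inj₂ (inj₂ (a , b))) = inj₂ b
    separated : ∀ x y g g' → x ∈ B → y ∈ B → E G x y → g ∈ F → g' ∈ F → Cyclic p x g y → Cyclic p y g' x → ⊥
    separated x y g g' xB yB exy gF g'F h1 h2 with <-cmp (p x) (p y)
    ... | tri< lt _ _ = sep x y xB yB exy lt (g , g' , gF , g'F , cyclic-linear p lt h1 , outside lt h2)
    ... | tri≈ _ e _ = E-irrefl (subst (λ z → E G x z) (esym (inj x y e)) exy)
    ... | tri> _ _ gt = sep y x yB xB (E-sym exy) gt (g' , g , g'F , gF , cyclic-linear p gt h2 , outside gt h1)

  cycFace→face : ∀ p B F → CycFace p B F → Face' p B F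
  cycFace→face p B F (sub , sz , consecutive , separated) = sub , sz , sides , sep
    where
    sides : ∀ f f' → f ∈ F → f' ∈ F → p f < p f' →
         ((∀ g → g ∈ F → ¬ (p f < p g × p g < p f')) → E G f f') ×
         ((∀ g → g ∈ F → p f ≤ p g × p g ≤ p f') → E G f f')
    sides f f' fF f'F lt =
      (λ h → consecutive f f' fF f'F (λ e → <-irrefl (cong p e) lt) (λ g gF c → h g gF (cyclic-linear p lt c))) ,
      (λ h → E-sym (consecutive f' f f'F fF (λ e → <-irrefl (cong p (esym e)) lt) (λ g gF c → wrap g (h g gF) c)))
      where
      wrap : ∀ g → p f ≤ p g × p g ≤ p f' → ¬ Cyclic p f' g f
      wrap g (a , b) (inj₁ (x , y)) = <-irrefl refl (<-≤-trans x b)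
      wrap g (a , b) (inj₂ (inj₁ (x , y))) = <-irrefl refl (<-≤-trans x a)
      wrap g (a , b) (inj₂ (inj₂ (x , y))) = <-irrefl refl (<-≤-trans y b)
    sep : ∀ x y → x ∈ B → y ∈ B → E G x y → p x < p y →
         ¬ (∃₂ λ g g' → g ∈ F × g' ∈ F × (p x < p g × p g < p y) × (p g' < p x ⊎ p y < p g'))
    sep x y xB yB exy lt (g , g' , gF , g'F , btw , inj₁ o) =
      separated x y g g' xB yB exy gF g'F (inj₁ btw) (inj₂ (inj₁ (o , lt)))
    sep x y xB yB exy lt (g , g' , gF , g'F , btw , inj₂ o) =
      separated x y g g' xB yB exy gF g'F (inj₁ btw) (inj₂ (inj₂ (lt , o)))

  face-transfer : ∀ a b B F → Injective a →
                  (∀ {u v w} → Cyclic a u v w → Cyclic b u v w) → (∀ {u v w} → Cyclic b u v w → Cyclic a u v w) →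
                  Face' a B F → Face' b B F
  face-transfer a b B F ia t t' lf with face→cycFace a B F ia lf
  ... | (sub , sz , consecutive , separated) = cycFace→face b B F
    (sub , sz ,
     (λ f f' fF f'F ne h → consecutive f f' fF f'F ne (λ g gF c → h g gF (t c))) ,
     (λ x y g g' xB yB e gF g'F c1 c2 → separated x y g g' xB yB e gF g'F (t' c1) (t' c2)))

  simple-transfer : ∀ p q B → Injective p → Injective q →
                    (∀ {u v w} → Cyclic p u v w → Cyclic q u v w) → (∀ {u v w} → Cyclic q u v w → Cyclic p u v w) →
                    Simple' p B → Simple' q B
  simple-transfer p q B ip iq t t' S F₁ F₂ f1 f2
    with S F₁ F₂ (face-transfer q p B F₁ iq t' t f1) (face-transfer q p B F₂ iq t' t f2)
  ... | inj₁ e = inj₁ e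
  ... | inj₂ (inj₁ a) = inj₂ (inj₁ a)
  ... | inj₂ (inj₂ (F₃ , f3 , a1 , a2)) = inj₂ (inj₂ (F₃ , face-transfer p q B F₃ ip t t' f3 , a1 , a2))

-- A vertex v of degree ≤ 2 sees in G² only its neighbours
-- and their neighbours, so deg² v is bounded by the degrees of its
-- neighbours, with a saving when the neighbours are adjacent or when all
-- of them lie in the closed neighbourhood of a single vertex.

module _ {n : ℕ} (G : Graph n) where

  adj²-witness : ∀ v j → adj² G v j ≡ true → v ≢ j × ∃ λ w → E G v w × (j ≡ w ⊎ E G w j)
  adj²-witness v j h with ∧-elim {not ⌊ v ≟ j ⌋} h
  ... | (h1 , h2) with ∨-elim {adj G v j} h2
  ...   | inj₁ e = ≢-of-isEq h1 , j , e , inj₁ refl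
  ...   | inj₂ a with anyFin-∃ (λ w → adj G v w ∧ adj G w j) a
  ...     | (w , q) = ≢-of-isEq h1 , w , proj₁ (∧-elim q) , inj₂ (proj₂ (∧-elim q))

  deg²≤count : ∀ v (g : Fin n → Bool) → (∀ j w → v ≢ j → E G v w → (j ≡ w ⊎ E G w j) → g j ≡ true) →
               deg² G v ≤ count g
  deg²≤count v g h =
    count-mono {n} (adj² G v) g (λ j e → let (ne , w , ew , r) = adj²-witness v j e in h j w ne ew r)

  deg≤1 : ∀ v a → (∀ w → E G v w → w ≡ a) → deg G v ≤ 1
  deg≤1 v a h = subst (_ ≤_) (count-single a) (count-mono {n} (adj G v) (λ j → isEq j a) (λ j e → isEq-≡ (h j e)))

  deg≤2 : ∀ v a b → (∀ w → E G v w → w ≡ a ⊎ w ≡ b) → deg G v ≤ 2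
  deg≤2 v a b = count≤2 (adj G v) a b

  deg≤3 : ∀ v a b d → (∀ w → E G v w → w ≡ a ⊎ w ≡ b ⊎ w ≡ d) → deg G v ≤ 3
  deg≤3 v a b d = count≤3 (adj G v) a b d

  closedNbhd-minus : ∀ a v → E G a v → count (λ j → (isEq j a ∨ adj G a j) ∧ not (isEq j v)) ≤ deg G a
  closedNbhd-minus a v e =
    +-cancelˡ-≤ 1 _ _ (≤-trans (≤-reflexive (count-del {n} (λ j → isEq j a ∨ adj G a j) v (∨-introʳ _ e)))
      (≤-trans (count-∨ {n} _ _) (≤-reflexive (cong (_+ deg G a) (count-single a)))))

  reachedVia : Fin n → Fin n → Fin n → Bool
  reachedVia v a j = adj G v a ∧ ((isEq j a ∨ adj G a j) ∧ not (isEq j v))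

  reachedVia-count : ∀ v a → count (reachedVia v a) ≤ deg G a
  reachedVia-count v a with adj G v a in e
  ... | true = closedNbhd-minus a v (E-sym G e)
  ... | false = subst (_≤ deg G a) (esym (count-zero {n} (λ j → false) (λ _ → refl))) z≤n

  reachedVia-covers : ∀ v a j → v ≢ j → E G v a → (j ≡ a ⊎ E G a j) → reachedVia v a j ≡ true
  reachedVia-covers v a j ne e r = ∧-intro e (∧-intro (closed r) (isEq-≢ (λ q → ne (esym q))))
    where
    closed : (j ≡ a ⊎ E G a j) → (isEq j a ∨ adj G a j) ≡ true
    closed (inj₁ q) = ∨-introˡ _ (isEq-≡ q)
    closed (inj₂ q) = ∨-introʳ _ q

  deg²-one-nbr : ∀ v a → (∀ w → E G v w → w ≡ a) → deg² G v ≤ deg G a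
  deg²-one-nbr v a h = ≤-trans (deg²≤count v (reachedVia v a) covers) (reachedVia-count v a)
    where
    covers : ∀ j w → v ≢ j → E G v w → (j ≡ w ⊎ E G w j) → reachedVia v a j ≡ true
    covers j w ne ew r with h w ew
    ... | refl = reachedVia-covers v w j ne ew r

  deg²-two-nbrs : ∀ v a b → (∀ w → E G v w → w ≡ a ⊎ w ≡ b) → deg² G v ≤ deg G a + deg G b
  deg²-two-nbrs v a b h =
    ≤-trans (deg²≤count v (λ j → reachedVia v a j ∨ reachedVia v b j) covers)
      (≤-trans (count-∨ {n} _ _) (+-mono-≤ (reachedVia-count v a) (reachedVia-count v b)))
    where
    covers : ∀ j w → v ≢ j → E G v w → (j ≡ w ⊎ E G w j) → (reachedVia v a j ∨ reachedVia v b j) ≡ true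
    covers j w ne ew r with h w ew
    ... | inj₁ refl = ∨-introˡ _ (reachedVia-covers v w j ne ew r)
    ... | inj₂ refl = ∨-introʳ _ (reachedVia-covers v w j ne ew r)

  -- A vertex in a triangle v a b with no other neighbours:
  -- deg² v + 2 ≤ deg a + deg b  (a and b each count v, and see each other).
  deg²-triangle : ∀ v a b → (∀ w → E G v w → w ≡ a ⊎ w ≡ b) → E G a b → E G v a → E G v b →
                  deg² G v + 2 ≤ deg G a + deg G b
  deg²-triangle v a b h eab eva evb =
    subst₂ _≤_ (+-comm 2 _) (add-both (count-del {n} (adj G a) v (E-sym G eva)) (count-del {n} (adj G b) v (E-sym G evb)))
      (+-monoʳ-≤ 2 (≤-trans (deg²≤count v (λ j → nbrA j ∨ nbrB j) covers) (count-∨ {n} _ _)))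
    where
    nbrA = λ j → adj G a j ∧ not (isEq j v)
    nbrB = λ j → adj G b j ∧ not (isEq j v)
    add-both : ∀ {x y x' y'} → suc x ≡ x' → suc y ≡ y' → 2 + (x + y) ≡ x' + y'
    add-both {x} {y} refl refl = cong suc (esym (+-suc x y))
    notV : ∀ j → v ≢ j → not (isEq j v) ≡ true
    notV j ne = isEq-≢ (λ q → ne (esym q))
    covers : ∀ j w → v ≢ j → E G v w → (j ≡ w ⊎ E G w j) → (nbrA j ∨ nbrB j) ≡ true
    covers j w ne ew r with h w ew
    covers j w ne ew (inj₁ refl) | inj₁ refl = ∨-introʳ _ (∧-intro (E-sym G eab) (notV j ne))
    covers j w ne ew (inj₂ q) | inj₁ refl = ∨-introˡ _ (∧-intro q (notV j ne))
    covers j w ne ew (inj₁ refl) | inj₂ refl = ∨-introˡ _ (∧-intro eab (notV j ne))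
    covers j w ne ew (inj₂ q) | inj₂ refl = ∨-introʳ _ (∧-intro q (notV j ne))

  deg²-fan : ∀ v c → E G c v → (∀ j w → v ≢ j → E G v w → (j ≡ w ⊎ E G w j) → j ≡ c ⊎ E G c j) →
             deg² G v ≤ deg G c
  deg²-fan v c ecv h =
    ≤-trans (deg²≤count v (λ j → (isEq j c ∨ adj G c j) ∧ not (isEq j v)) covers) (closedNbhd-minus c v ecv)
    where
    covers : ∀ j w → v ≢ j → E G v w → (j ≡ w ⊎ E G w j) → ((isEq j c ∨ adj G c j) ∧ not (isEq j v)) ≡ true
    covers j w ne ew r with h j w ne ew r
    ... | inj₁ q = ∧-intro (∨-introˡ _ (isEq-≡ q)) (isEq-≢ (λ q → ne (esym q)))
    ... | inj₂ q = ∧-intro (∨-introʳ _ q) (isEq-≢ (λ q → ne (esym q)))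

  -- Two adjacent neighbours a, b:  deg² v ≤ M  once the degrees of a, b are
  -- each at most M and together at most M + 2 (the triangle saves 2; if an
  -- edge to a or b is missing, v has a single neighbour).
  deg²-adjacent-nbrs : ∀ v a b {A Bd M} → (∀ w → E G v w → w ≡ a ⊎ w ≡ b) → E G a b →
                       deg G a ≤ A → deg G b ≤ Bd → A ≤ M → Bd ≤ M → A + Bd ≤ M + 2 → deg² G v ≤ M
  deg²-adjacent-nbrs v a b {M = M} nbrs eab da db A≤M B≤M sum with adj G v a in ea | adj G v b in eb
  ... | true | true = +-cancelʳ-≤ 2 _ M (≤-trans (deg²-triangle v a b nbrs eab ea eb) (≤-trans (+-mono-≤ da db) sum))
  ... | false | _ = ≤-trans (deg²-one-nbr v b only-b) (≤-trans db B≤M)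
    where
    only-b : ∀ w → E G v w → w ≡ b
    only-b w ew with nbrs w ew
    ... | inj₁ refl with () ← trans (esym ea) ew
    ... | inj₂ q = q
  ... | true | false = ≤-trans (deg²-one-nbr v a only-a) (≤-trans da A≤M)
    where
    only-a : ∀ w → E G v w → w ≡ a
    only-a w ew with nbrs w ew
    ... | inj₂ refl with () ← trans (esym eb) ew
    ... | inj₁ q = q

-- Blocks.  Every biconnected vertex set, in particular every edge, lies in
-- a block; so an edge leaving a block B at v makes v a cutvertex.

module _ {n : ℕ} (G : Graph n) where

  reach-first-step : ∀ {P : Fin n → Set} {x y} → Reach G P x y → x ≢ y → ∃ λ z → E G x z × P z
  reach-first-step (here _) ne = ⊥-elim (ne refl)
  reach-first-step {x = x} (step {y = y} {z = z} r e pz) ne with x ≟ y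
  ... | yes refl = z , e , pz
  ... | no ne' = reach-first-step r ne'

  pair : Fin n → Fin n → Subset n
  pair v w = ⁅ v ⁆ ∪ ⁅ w ⁆

  pair-mem : ∀ {v w x} → x ∈ pair v w → x ≡ v ⊎ x ≡ w
  pair-mem {v} {w} h with x∈p∪q⁻ ⁅ v ⁆ ⁅ w ⁆ h
  ... | inj₁ a = inj₁ (x∈⁅y⁆⇒x≡y v a)
  ... | inj₂ b = inj₂ (x∈⁅y⁆⇒x≡y w b)

  pair-left : ∀ v w → v ∈ pair v w
  pair-left v w = x∈p∪q⁺ (inj₁ (x∈⁅x⁆ v))

  pair-right : ∀ v w → w ∈ pair v w
  pair-right v w = x∈p∪q⁺ (inj₂ (x∈⁅x⁆ w))

  edge-connected : ∀ v w (P : Fin n → Set) → E G v w → (∀ x → P x → x ≡ v ⊎ x ≡ w) → Connected G P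
  edge-connected v w P e h x y px py with h x px | h y py
  ... | inj₁ refl | inj₁ refl = here px
  ... | inj₂ refl | inj₂ refl = here px
  ... | inj₁ refl | inj₂ refl = step (here px) e py
  ... | inj₂ refl | inj₁ refl = step (here px) (E-sym G e) py

  edge-biconnected : ∀ v w → E G v w → Biconnected G (pair v w)
  edge-biconnected v w e =
    (v , pair-left v w) , edge-connected v w _ e (λ x → pair-mem) ,
    (λ u _ → edge-connected v w _ e (λ x h → pair-mem (proj₁ h)))

  blockAboveAcc : ∀ S → Acc _<_ (n ∸ ∣ S ∣) → Biconnected G S → (∀ T → Block G T → S ⊆ T → ⊥) → ⊥
  blockAboveAcc S (acc rs) bS k = byCases larger (λ none → k S (bS , maximal none) (λ x → x))
    where
    Larger : Set
    Larger = ∃ λ T → S ⊆ T × Biconnected G T × ∃ λ x → x ∈ T × ¬ x ∈ S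
    larger : Larger → ⊥
    larger (T , S⊆T , bT , x , xT , x∉S) =
      blockAboveAcc T (rs (∸-monoʳ-< (p⊂q⇒∣p∣<∣q∣ (S⊆T , x , xT , x∉S)) (∣p∣≤n T))) bT
        (λ T' bl T⊆T' → k T' bl (λ y → T⊆T' (S⊆T y)))
    maximal : ¬ Larger → ∀ T → S ⊆ T → Biconnected G T → T ⊆ S
    maximal none T S⊆T bT {x} xT with x ∈? S
    ... | yes q = q
    ... | no q = ⊥-elim (none (T , S⊆T , bT , x , xT , q))

  blockAbove : ∀ S → Biconnected G S → (∀ T → Block G T → S ⊆ T → ⊥) → ⊥
  blockAbove S = blockAboveAcc S (<-wellFounded _)

  nbr-in-block : ∀ B c → Block G B → (∀ u → u ∈ B → Cutvertex G u → u ≡ c) →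
                 ∀ v w → v ∈ B → v ≢ c → E G v w → w ∈ B
  nbr-in-block B c bB cut v w vB v≢c e with w ∈? B
  ... | yes q = q
  ... | no q = ⊥-elim (blockAbove (pair v w) (edge-biconnected v w e) λ T bT sub →
          v≢c (cut v vB (B , T , bB , bT , (λ eq → q (subst (w ∈_) (esym eq) (sub (pair-right v w)))) ,
                         vB , sub (pair-left v w))))

module _ {n : ℕ} (G : Graph n) (B : Subset n) where

  record Drawing : Set where
    field
      p         : Fin n → ℕ
      N         : ℕ
      p<N       : ∀ v → p v < N
      injective : Injective G p
      noCross   : NoCross G p
      simple    : Simple' G p B

  rotateAt : Drawing → ℕ → Drawing
  rotateAt D s = record
    { p = p'
    ; N = N + N
    ; p<N = bounded'
    ; injective = injective' injective
    ; noCross = cyc→noCross G p' (λ a b c d eab ecd h1 h2 →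
                  noCross→cyc G p noCross a b c d eab ecd (cyclic'→cyclic h1) (cyclic'→cyclic h2))
    ; simple = simple-transfer G p p' B injective (injective' injective) cyclic→cyclic' cyclic'→cyclic simple
    }
    where
    open Drawing D
    open Rotation s N p p<N

  rotated-cyclic : ∀ D s {u v w} → Cyclic (Drawing.p (rotateAt D s)) u v w → Cyclic (Drawing.p D) u v w
  rotated-cyclic D s = Rotation.cyclic'→cyclic s (Drawing.N D) (Drawing.p D) (Drawing.p<N D)

  rotated-first : ∀ D c v → v ≢ c →
                  Drawing.p (rotateAt D (Drawing.p D c)) c < Drawing.p (rotateAt D (Drawing.p D c)) v
  rotated-first D c v ne =
    Rotation.start-first (Drawing.p D c) (Drawing.N D) (Drawing.p D) (Drawing.p<N D) c v refl ne (Drawing.injective D)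

  reach-end : ∀ {P : Fin n → Set} {x y} → Reach G P x y → P y
  reach-end (here q) = q
  reach-end (step _ _ q) = q

  -- Otherwise let w be the first neighbour
  -- of a in B; a path from b to a in B - w stays before w (an edge jumping
  -- over w would cross aw) and so reaches a through a neighbour before w.
  module FirstEdge (p : Fin n → ℕ) (inj : Injective G p) (noCross : NoCross G p) (bic : Biconnected G B)
                   (a b : Fin n) (aB : a ∈ B) (bB : b ∈ B) (ab : p a < p b)
                   (a-first : ∀ u → u ∈ B → u ≢ a → p a < p u)
                   (b-next : ∀ u → u ∈ B → ¬ (p a < p u × p u < p b)) where

    a≢b : a ≢ b
    a≢b e = <-irrefl (cong p e) ab

    module AvoidingFirstNbr (w : Fin n) (ew : E G a w) (wB : w ∈ B)
                            (w-first : ∀ y → y ∈ B → E G a y → p w ≤ p y) (¬ab : ¬ E G a b) where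
      BeforeW : Fin n → Set
      BeforeW z = z ≢ a × p z < p w

      b<w : p b < p w
      b<w with <-cmp (p b) (p w)
      ... | tri< l _ _ = l
      ... | tri≈ _ e _ = ⊥-elim (¬ab (subst (E G a) (esym (inj b w e)) ew))
      ... | tri> _ _ g = ⊥-elim (b-next w wB (a-first w wB (λ e → E-≢ G ew (esym e)) , g))

      stays-before : ∀ {x z} → Reach G (λ u → u ∈ B × u ≢ w) x z → BeforeW x → BeforeW z
      stays-before (here _) i = i
      stays-before (step {y = y} {z = z} r e (zB , z≢w)) i with stays-before r i
      ... | (y≢a , y<w) = z≢a , z<w
        where
        yB : y ∈ B
        yB = proj₁ (reach-end r)
        z≢a : z ≢ a
        z≢a refl = <-irrefl refl (<-≤-trans y<w (w-first y yB (E-sym G e)))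
        z<w : p z < p w
        z<w with <-cmp (p z) (p w)
        ... | tri< l _ _ = l
        ... | tri≈ _ q _ = ⊥-elim (z≢w (inj z w q))
        ... | tri> _ _ g = ⊥-elim (noCross a w y z ew e (a-first y yB y≢a , y<w , g))

      contradiction : ⊥
      contradiction =
        proj₁ (stays-before (proj₂ (proj₂ bic) w wB b a (bB , λ e → <-irrefl (cong p e) b<w) (aB , λ e → E-≢ G ew e))
                            ((λ e → a≢b (esym e)) , b<w)) refl

    adjacent : E G a b
    adjacent = true-stable λ ¬ab → some-nbr (reach-first-step G (proj₁ (proj₂ bic) a b aB bB) a≢b) ¬ab
      where
      some-nbr : (∃ λ z → E G a z × z ∈ B) → ¬ E G a b → ⊥
      some-nbr (z , ez , zB) ¬ab = withMinimal (λ y → E G a y × y ∈ B) p z (ez , zB)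
        (λ w (ew , wB) mn → AvoidingFirstNbr.contradiction w ew wB (λ y yB ey → mn y (ey , yB)) ¬ab)

  -- Cyclically consecutive vertices of B are adjacent: rotate a to the front.
  consecutive-adjacent : (D : Drawing) → Biconnected G B → ∀ a b → a ∈ B → b ∈ B → a ≢ b →
                         (∀ g → g ∈ B → ¬ Cyclic (Drawing.p D) a g b) → E G a b
  consecutive-adjacent D bic a b aB bB ne h =
    FirstEdge.adjacent p' (Drawing.injective D') (Drawing.noCross D') bic a b aB bB
      (rotated-first D a b (λ e → ne (esym e)))
      (λ u uB ua → rotated-first D a u ua)
      (λ u uB (l1 , l2) → h u uB (rotated-cyclic D (Drawing.p D a) (inj₁ (l1 , l2))))
    where
    D' = rotateAt D (Drawing.p D a)
    p' = Drawing.p D'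

-- For a chord xy of B with x before y and some vertex
-- of B strictly between them, the vertices of B in [x, y] that are not
-- covered by another edge of B inside [x, y] form a face, the inner face
-- of xy.  In a simple block no chord separates two faces that meet it only
-- in its ends.

module InDrawing {n : ℕ} (G : Graph n) (B : Subset n) (D : Drawing G B) (bic : Biconnected G B) where
  open Drawing D

  p-inj : ∀ {a b} → p a ≡ p b → a ≡ b
  p-inj {a} {b} = injective a b

  ≤≢⇒<ₚ : ∀ {a b} → p a ≤ p b → a ≢ b → p a < p b
  ≤≢⇒<ₚ h ne = ≤∧≢⇒< h (λ e → ne (p-inj e))

  next-adjacent : ∀ u v → u ∈ B → v ∈ B → p u < p v → (∀ g → g ∈ B → ¬ (p u < p g × p g < p v)) → E G u v
  next-adjacent u v uB vB lt h =
    consecutive-adjacent G B D bic u v uB vB (λ e → <-irrefl (cong p e) lt) (λ g gB c → h g gB (cyclic-linear p lt c))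

  Covered : Fin n → Fin n → Fin n → Set
  Covered x y z = ∃₂ λ a b → a ∈ B × b ∈ B × E G a b ×
                  p x ≤ p a × p a < p z × p z < p b × p b ≤ p y × ¬ (a ≡ x × b ≡ y)

  covered? : ∀ x y z → Dec (Covered x y z)
  covered? x y z = any? (λ a → any? (λ b → (a ∈? B) ×-dec ((b ∈? B) ×-dec ((adj G a b Bool.≟ true) ×-dec
                     ((p x ≤? p a) ×-dec ((p a <? p z) ×-dec ((p z <? p b) ×-dec ((p b ≤? p y) ×-dec
                     ¬? ((a ≟ x) ×-dec (b ≟ y))))))))))

  InnerVertex : Fin n → Fin n → Fin n → Set
  InnerVertex x y z = z ∈ B × p x ≤ p z × p z ≤ p y × ¬ Covered x y z

  innerVertex? : ∀ x y z → Dec (InnerVertex x y z)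
  innerVertex? x y z = (z ∈? B) ×-dec ((p x ≤? p z) ×-dec ((p z ≤? p y) ×-dec ¬? (covered? x y z)))

  innerFace : Fin n → Fin n → Subset n
  innerFace x y = tabulate (λ z → ⌊ innerVertex? x y z ⌋)

  innerFace→ : ∀ {x y z} → z ∈ innerFace x y → InnerVertex x y z
  innerFace→ {x} {y} {z} h = dec-true (innerVertex? x y z) (trans (esym (lookup∘tabulate _ z)) (mem→ h))

  innerFace← : ∀ {x y z} → InnerVertex x y z → z ∈ innerFace x y
  innerFace← {x} {y} {z} h = mem← (trans (lookup∘tabulate _ z) (true-dec (innerVertex? x y z) h))

  inner-lower : ∀ {x y z} → z ∈ innerFace x y → p x ≤ p z
  inner-lower h = proj₁ (proj₂ (innerFace→ h))

  inner-upper : ∀ {x y z} → z ∈ innerFace x y → p z ≤ p y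
  inner-upper h = proj₁ (proj₂ (proj₂ (innerFace→ h)))

  inner-uncovered : ∀ {x y z} → z ∈ innerFace x y → ¬ Covered x y z
  inner-uncovered h = proj₂ (proj₂ (proj₂ (innerFace→ h)))

  module InnerFace (x y : Fin n) (xB : x ∈ B) (yB : y ∈ B) (exy : E G x y) (xy : p x < p y)
                   (g0 : Fin n) (g0B : g0 ∈ B) (x<g0 : p x < p g0) (g0<y : p g0 < p y) where

    x-inner : InnerVertex x y x
    x-inner = xB , ≤-refl , <⇒≤ xy , λ (a , b , _ , _ , _ , l1 , l2 , _) → <-irrefl refl (<-≤-trans l2 l1)

    y-inner : InnerVertex x y y
    y-inner = yB , <⇒≤ xy , ≤-refl , λ (a , b , _ , _ , _ , _ , _ , l3 , l4 , _) → <-irrefl refl (<-≤-trans l3 l4)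

    -- Some vertex strictly between x and y is inner: the last neighbour of
    -- x inside (x, y) if there is one, the first vertex of B after x if not.
    withMiddle : ((z : Fin n) → InnerVertex x y z → p x < p z → p z < p y → ⊥) → ⊥
    withMiddle k = byCases withInnerNbr noInnerNbr
      where
      InnerNbr : Fin n → Set
      InnerNbr w = E G x w × w ∈ B × p x < p w × p w < p y
      withInnerNbr : ∃ InnerNbr → ⊥
      withInnerNbr (w0 , nw0) = withMaximal InnerNbr p N (λ y _ → <⇒≤ (p<N y)) w0 nw0
        (λ w (ew , wB , xw , wy) mx → k w (wB , <⇒≤ xw , <⇒≤ wy , uncovered w ew xw mx) xw wy)
        where
        uncovered : ∀ w → E G x w → p x < p w → (∀ z → InnerNbr z → p z ≤ p w) → ¬ Covered x y w
        uncovered w ew xw mx (a , b , aB , bB , eab , xa , aw , wb , by , ¬xy) with a ≟ x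
        ... | yes refl = <-irrefl refl (<-≤-trans wb (mx b (eab , bB , <-trans xw wb , ≤≢⇒<ₚ by (λ e → ¬xy (refl , e)))))
        ... | no ax = noCross x w a b ew eab (≤≢⇒<ₚ xa (λ e → ax (esym e)) , aw , wb)
      noInnerNbr : ¬ (∃ InnerNbr) → ⊥
      noInnerNbr nn = withMinimal (λ z → z ∈ B × p x < p z) p g0 (g0B , x<g0)
        (λ g1 (g1B , xg1) mn → let g1y = ≤-<-trans (mn g0 (g0B , x<g0)) g0<y in
                                k g1 (g1B , <⇒≤ xg1 , <⇒≤ g1y , uncovered g1 g1B xg1 mn) xg1 g1y)
        where
        uncovered : ∀ g1 → g1 ∈ B → p x < p g1 → (∀ z → z ∈ B × p x < p z → p g1 ≤ p z) → ¬ Covered x y g1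
        uncovered g1 g1B xg1 mn (a , b , aB , bB , eab , xa , ag , gb , by , ¬xy) with a ≟ x
        ... | yes refl = nn (b , eab , bB , <-trans xg1 gb , ≤≢⇒<ₚ by (λ e → ¬xy (refl , e)))
        ... | no ax = <-irrefl refl (<-≤-trans ag (mn a (aB , ≤≢⇒<ₚ xa (λ e → ax (esym e)))))

    size : 3 ≤ ∣ innerFace x y ∣
    size = ≮⇒≥ λ lt → withMiddle (λ z zI xz zy →
             <-irrefl refl (<-≤-trans lt (three≤∣∣ (innerFace x y) x y z
               (innerFace← x-inner) (innerFace← y-inner) (innerFace← zI)
               (λ e → <-irrefl (cong p e) xy) (λ e → <-irrefl (cong p e) xz) (λ e → <-irrefl (cong p (esym e)) zy))))

    span : Fin n × Fin n → ℕ
    span (a , b) = p b ∸ p a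

    span-< : ∀ {a b a' b'} → p a < p b → p a' < p a → p b ≤ p b' → p b ∸ p a < p b' ∸ p a'
    span-< {a} {b} {a'} {b'} ab a'a bb' = <-≤-trans (∸-monoʳ-< a'a (<⇒≤ ab)) (∸-monoˡ-≤ (p a') bb')

    span-<' : ∀ {a b a' b'} → p a < p b → p a' ≤ p a → p b < p b' → p b ∸ p a < p b' ∸ p a'
    span-<' {a} {b} {a'} {b'} ab a'a bb' = <-≤-trans (∸-monoˡ-< bb' (<⇒≤ ab)) (∸-monoʳ-≤ (p b') a'a)

    ≮≯⇒≡ : ∀ {a b} → ¬ p a < p b → ¬ p b < p a → a ≡ b
    ≮≯⇒≡ {a} {b} h1 h2 with <-cmp (p a) (p b)
    ... | tri< l _ _ = ⊥-elim (h1 l)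
    ... | tri≈ _ e _ = p-inj e
    ... | tri> _ _ g = ⊥-elim (h2 g)

    CoveringEdge : Fin n → Fin n × Fin n → Set
    CoveringEdge z (a , b) = a ∈ B × b ∈ B × E G a b × p x ≤ p a × p a < p z × p z < p b × p b ≤ p y × ¬ (a ≡ x × b ≡ y)

    module WidestCover (z a b : Fin n) (cov : CoveringEdge z (a , b))
                       (widest : ∀ q → CoveringEdge z q → span q ≤ span (a , b)) where
      aB = proj₁ cov
      bB = proj₁ (proj₂ cov)
      eab = proj₁ (proj₂ (proj₂ cov))
      xa = proj₁ (proj₂ (proj₂ (proj₂ cov)))
      az = proj₁ (proj₂ (proj₂ (proj₂ (proj₂ cov))))
      zb = proj₁ (proj₂ (proj₂ (proj₂ (proj₂ (proj₂ cov)))))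
      by = proj₁ (proj₂ (proj₂ (proj₂ (proj₂ (proj₂ (proj₂ cov))))))
      ¬xy = proj₂ (proj₂ (proj₂ (proj₂ (proj₂ (proj₂ (proj₂ cov))))))
      ab = <-trans az zb

      a-inner : InnerVertex x y a
      a-inner = aB , xa , <⇒≤ (<-≤-trans ab by) , uncovered
        where
        uncovered : ¬ Covered x y a
        uncovered (a' , b' , a'B , b'B , e' , xa' , a'a , ab' , b'y , ¬xy') with <-cmp (p b') (p b)
        ... | tri< l _ _ = noCross a' b' a b e' eab (a'a , ab' , l)
        ... | tri≈ _ e _ = <-irrefl refl (<-≤-trans (span-< ab a'a (≤-reflexive (esym e)))
                (widest (a' , b') (a'B , b'B , e' , xa' , <-trans a'a az , <-≤-trans zb (≤-reflexive (esym e)) , b'y , ¬xy')))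
        ... | tri> _ _ g = <-irrefl refl (<-≤-trans (span-< ab a'a (<⇒≤ g))
                (widest (a' , b') (a'B , b'B , e' , xa' , <-trans a'a az , <-trans zb g , b'y , ¬xy')))

      b-inner : InnerVertex x y b
      b-inner = bB , <⇒≤ (≤-<-trans xa ab) , by , uncovered
        where
        uncovered : ¬ Covered x y b
        uncovered (a' , b' , a'B , b'B , e' , xa' , a'b , bb' , b'y , ¬xy') with <-cmp (p a) (p a')
        ... | tri< l _ _ = noCross a b a' b' eab e' (l , a'b , bb')
        ... | tri≈ _ e _ = <-irrefl refl (<-≤-trans (span-<' ab (≤-reflexive (esym e)) bb')
                (widest (a' , b') (a'B , b'B , e' , xa' , ≤-<-trans (≤-reflexive (esym e)) az , <-trans zb bb' , b'y , ¬xy')))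
        ... | tri> _ _ g = <-irrefl refl (<-≤-trans (span-<' ab (<⇒≤ g) bb')
                (widest (a' , b') (a'B , b'B , e' , xa' , <-trans g az , <-trans zb bb' , b'y , ¬xy')))

    -- Consecutive inner vertices f < f' are adjacent: either f f' are
    -- consecutive in B, or a vertex between them is covered and the widest
    -- covering edge is ff'.
    consecutive-edge : ∀ f f' → f ∈ innerFace x y → f' ∈ innerFace x y → p f < p f' →
                       (∀ g → g ∈ innerFace x y → ¬ (p f < p g × p g < p f')) → E G f f'
    consecutive-edge f f' fI f'I lt none = true-stable λ ¬E →
      byCases (λ ex → between ex ¬E)
              (λ nex → ¬E (next-adjacent f f' (proj₁ (innerFace→ fI)) (proj₁ (innerFace→ f'I)) lt (λ g gB b → nex (g , gB , b))))
      where
      between : (∃ λ z → z ∈ B × p f < p z × p z < p f') → ¬ E G f f' → ⊥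
      between (z , zB , fz , zf') ¬E = z-inner-or-covered widestCover
        where
        xz : p x ≤ p z
        xz = <⇒≤ (≤-<-trans (inner-lower fI) fz)
        zy : p z ≤ p y
        zy = <⇒≤ (<-≤-trans zf' (inner-upper f'I))
        z-inner-or-covered : (Covered x y z → ⊥) → ⊥
        z-inner-or-covered k = none z (innerFace← (zB , xz , zy , k)) (fz , zf')
        widestCover : Covered x y z → ⊥
        widestCover (a0 , b0 , c0) =
          withMaximal (CoveringEdge z) span N (λ { (a , b) _ → ≤-trans (m∸n≤m (p b) (p a)) (<⇒≤ (p<N b)) }) (a0 , b0) c0
            (λ { (a , b) cov widest → ends-are-f-f' a b cov widest })
          where
          ends-are-f-f' : ∀ a b → CoveringEdge z (a , b) → (∀ q → CoveringEdge z q → span q ≤ span (a , b)) → ⊥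
          ends-are-f-f' a b cov widest = ¬E (subst₂ (E G) a≡f b≡f' eab)
            where
            open WidestCover z a b cov widest
            a≡f : a ≡ f
            a≡f = ≮≯⇒≡ (λ a<f → inner-uncovered fI (a , b , aB , bB , eab , xa , a<f , <-trans fz zb , by , ¬xy))
                        (λ f<a → none a (innerFace← a-inner) (f<a , <-trans az zf'))
            b≡f' : b ≡ f'
            b≡f' = ≮≯⇒≡ (λ b<f' → none b (innerFace← b-inner) (<-trans fz zb , b<f'))
                         (λ f'<b → inner-uncovered f'I (a , b , aB , bB , eab , xa , <-trans az zf' , f'<b , by , ¬xy))

    -- The extreme inner vertices are x and y, which are adjacent.
    extreme-edge : ∀ f f' → f ∈ innerFace x y → f' ∈ innerFace x y → p f < p f' →
                   (∀ g → g ∈ innerFace x y → p f ≤ p g × p g ≤ p f') → E G f f'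
    extreme-edge f f' fI f'I lt hall = subst₂ (E G) (esym f≡x) (esym f'≡y) exy
      where
      f≡x : f ≡ x
      f≡x = p-inj (≤-antisym (proj₁ (hall x (innerFace← x-inner))) (inner-lower fI))
      f'≡y : f' ≡ y
      f'≡y = p-inj (≤-antisym (inner-upper f'I) (proj₂ (hall y (innerFace← y-inner))))

    -- No edge uv of B has inner vertices on both sides: by non-crossing
    -- with xy when uv sticks out of [x, y], and by uncoveredness otherwise.
    no-separating-edge : ∀ u v → u ∈ B → v ∈ B → E G u v → p u < p v →
         ¬ (∃₂ λ g g' → g ∈ innerFace x y × g' ∈ innerFace x y × (p u < p g × p g < p v) × (p g' < p u ⊎ p v < p g'))
    no-separating-edge u v uB vB euv uv (g , g' , gI , g'I , (ug , gv) , out) = go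
      where
      xg = inner-lower gI
      gy = inner-upper gI
      g-uncovered = inner-uncovered gI
      spans-xy : p u ≤ p x → p y ≤ p v → ⊥
      spans-xy ux yv = g'-inside out
        where
        g'-inside : p g' < p u ⊎ p v < p g' → ⊥
        g'-inside (inj₁ l) = <-irrefl refl (<-≤-trans l (≤-trans ux (inner-lower g'I)))
        g'-inside (inj₂ l) = <-irrefl refl (<-≤-trans l (≤-trans (inner-upper g'I) yv))
      go : ⊥
      go with <-cmp (p u) (p x) | <-cmp (p v) (p y)
      ... | tri< ux _ _ | tri< vy _ _ = noCross u v x y euv exy (ux , ≤-<-trans xg gv , vy)
      ... | tri< ux _ _ | tri≈ _ vy _ = spans-xy (<⇒≤ ux) (≤-reflexive (esym vy))
      ... | tri< ux _ _ | tri> _ _ vy = spans-xy (<⇒≤ ux) (<⇒≤ vy)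
      ... | tri≈ _ ux _ | tri> _ _ vy = spans-xy (≤-reflexive ux) (<⇒≤ vy)
      ... | tri> _ _ xu | tri> _ _ vy = noCross x y u v exy euv (xu , <-≤-trans ug gy , vy)
      ... | tri≈ _ ux _ | tri≈ _ vy _ = spans-xy (≤-reflexive ux) (≤-reflexive (esym vy))
      ... | tri≈ _ ux _ | tri< vy _ _ = g-uncovered (u , v , uB , vB , euv , ≤-reflexive (esym ux) , ug , gv , <⇒≤ vy ,
                                                     λ (_ , e) → <-irrefl (cong p e) vy)
      ... | tri> _ _ xu | tri≈ _ vy _ = g-uncovered (u , v , uB , vB , euv , <⇒≤ xu , ug , gv , ≤-reflexive vy ,
                                                     λ (e , _) → <-irrefl (cong p (esym e)) xu)
      ... | tri> _ _ xu | tri< vy _ _ = g-uncovered (u , v , uB , vB , euv , <⇒≤ xu , ug , gv , <⇒≤ vy ,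
                                                     λ (e , _) → <-irrefl (cong p (esym e)) xu)

    face : Face' G p B (innerFace x y)
    face = (λ h → proj₁ (innerFace→ h)) , size ,
           (λ f f' fI f'I lt → consecutive-edge f f' fI f'I lt , extreme-edge f f' fI f'I lt) ,
           no-separating-edge

  withThirdVertex : ∀ F → Face' G p B F → ∀ a b → ((g : Fin n) → g ∈ F → g ≢ a → g ≢ b → ⊥) → ⊥
  withThirdVertex F lf a b k = <-irrefl refl (<-≤-trans (s≤s (s≤s (s≤s z≤n))) (≤-trans (proj₁ (proj₂ lf)) (∣∣≤2 F a b only-a-b)))
    where
    only-a-b : ∀ g → g ∈ F → g ≡ a ⊎ g ≡ b
    only-a-b g gF with g ≟ a | g ≟ b
    ... | yes e | _ = inj₁ e
    ... | no _ | yes e = inj₂ e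
    ... | no n1 | no n2 = ⊥-elim (k g gF n1 n2)

  pickOther : ∀ (X : Subset n) a b s s' → s ∈ X → s' ∈ X → s ≢ s' → ¬ (a ∈ X × b ∈ X) →
              ∃ λ t → t ∈ X × t ≢ a × t ≢ b × (t ≡ s ⊎ t ≡ s')
  pickOther X a b s s' sX s'X ne nab with s ≟ a | s ≟ b | s' ≟ a | s' ≟ b
  ... | no n1 | no n2 | _ | _ = s , sX , n1 , n2 , inj₁ refl
  ... | _ | _ | no n1 | no n2 = s' , s'X , n1 , n2 , inj₂ refl
  ... | yes refl | _ | yes refl | _ = ⊥-elim (ne refl)
  ... | yes refl | _ | no _ | yes refl = ⊥-elim (nab (sX , s'X))
  ... | no _ | yes refl | yes refl | _ = ⊥-elim (nab (s'X , sX))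
  ... | no _ | yes refl | no _ | yes refl = ⊥-elim (ne refl)

  -- Separation: faces A inside [a, b] and A' outside (a, b), neither
  -- containing the whole edge ab, are at distance ≥ 3 in the weak dual;
  -- so they cannot both exist in a simple block.
  chord-separates : ∀ a b A A' → a ∈ B → b ∈ B → E G a b → p a < p b → Face' G p B A → Face' G p B A' →
        (∀ g → g ∈ A → p a ≤ p g × p g ≤ p b) → ¬ (a ∈ A × b ∈ A) →
        (∀ g → g ∈ A' → ¬ (p a < p g × p g < p b)) → ¬ (a ∈ A' × b ∈ A') → ⊥
  chord-separates a b A A' aB bB eab ab lA lA' inA nA outA' nA' with simple A A' lA lA'
  ... | inj₁ refl = withThirdVertex A lA a b (λ g gA ga gb → outA' g gA (strictly-inside g gA ga gb))
    where
    strictly-inside : ∀ g → g ∈ A → g ≢ a → g ≢ b → p a < p g × p g < p b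
    strictly-inside g gA ga gb = ≤≢⇒<ₚ (proj₁ (inA g gA)) (λ e → ga (esym e)) , ≤≢⇒<ₚ (proj₂ (inA g gA)) gb
  ... | inj₂ (inj₁ (s , s' , sA , s'A , sA' , s'A' , e)) with pickOther A a b s s' sA s'A (E-≢ G e) nA
  ...   | (t , tA , ta , tb , inj₁ refl) = outA' t sA' (≤≢⇒<ₚ (proj₁ (inA t tA)) (λ q → ta (esym q)) , ≤≢⇒<ₚ (proj₂ (inA t tA)) tb)
  ...   | (t , tA , ta , tb , inj₂ refl) = outA' t s'A' (≤≢⇒<ₚ (proj₁ (inA t tA)) (λ q → ta (esym q)) , ≤≢⇒<ₚ (proj₂ (inA t tA)) tb)
  chord-separates a b A A' aB bB eab ab lA lA' inA nA outA' nA'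
    | inj₂ (inj₂ (F₃ , l3 , (s1 , s2 , s1A , s2A , s1F , s2F , e12) , (s3 , s4 , s3F , s4F , s3A , s4A , e34)))
    with pickOther A a b s1 s2 s1A s2A (E-≢ G e12) nA | pickOther A' a b s3 s4 s3A s4A (E-≢ G e34) nA'
  ... | (t , tA , ta , tb , o1) | (t' , tA' , ta' , tb' , o2) =
    proj₂ (proj₂ (proj₂ l3)) a b aB bB eab ab (t , t' , in-F₃ o1 , in-F₃' o2 , inside , outside)
    where
    in-F₃ : t ≡ s1 ⊎ t ≡ s2 → t ∈ F₃
    in-F₃ (inj₁ refl) = s1F
    in-F₃ (inj₂ refl) = s2F
    in-F₃' : t' ≡ s3 ⊎ t' ≡ s4 → t' ∈ F₃
    in-F₃' (inj₁ refl) = s3F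
    in-F₃' (inj₂ refl) = s4F
    inside = ≤≢⇒<ₚ (proj₁ (inA t tA)) (λ q → ta (esym q)) , ≤≢⇒<ₚ (proj₂ (inA t tA)) tb
    outside : p t' < p a ⊎ p b < p t'
    outside with <-cmp (p t') (p a) | <-cmp (p t') (p b)
    ... | tri< l _ _ | _ = inj₁ l
    ... | tri≈ _ e _ | _ = ⊥-elim (ta' (p-inj e))
    ... | tri> _ _ g | tri< l _ _ = ⊥-elim (outA' t' tA' (g , l))
    ... | tri> _ _ g | tri≈ _ e _ = ⊥-elim (tb' (p-inj e))
    ... | tri> _ _ g | tri> _ _ g' = inj₂ g'

-- Five true values of a predicate can be listed in increasing position.
-- Walk down from the last one: while at most four values are collected,
-- some other value lies below the current lowest.

module FiveIncreasing {n : ℕ} (f : Fin n → Bool) (p : Fin n → ℕ) (N : ℕ) (p<N : ∀ v → p v < N)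
                      (p-inj : ∀ x y → p x ≡ p y → x ≡ y) (five : 5 ≤ count f) where

  MarksFrom : (Fin n → Bool) → Fin n → Set
  MarksFrom q r = ∀ w → f w ≡ true → p r ≤ p w → q w ≡ true

  isEq-p : ∀ {w r} → p w ≡ p r → isEq w r ≡ true
  isEq-p e = isEq-≡ (p-inj _ _ e)

  below : ∀ q r → count q ≤ 4 → MarksFrom q r → ((w : Fin n) → f w ≡ true → p w < p r → ⊥) → ⊥
  below q r cq marks k = <-irrefl refl (<-≤-trans five (≤-trans (count-mono {n} f q all-marked) cq))
    where
    all-marked : ∀ w → f w ≡ true → q w ≡ true
    all-marked w e with <-cmp (p w) (p r)
    ... | tri< l _ _ = ⊥-elim (k w e l)
    ... | tri≈ _ eq _ = marks w e (≤-reflexive (esym eq))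
    ... | tri> _ _ g = marks w e (<⇒≤ g)

  stepDown : ∀ q r → count q ≤ 4 → MarksFrom q r →
             ((r' : Fin n) → f r' ≡ true → p r' < p r → MarksFrom (λ w → q w ∨ isEq w r') r' → ⊥) → ⊥
  stepDown q r cq marks k = below q r cq marks (λ w ew wr →
    withMaximal (λ v → f v ≡ true × p v < p r) p N (λ v _ → <⇒≤ (p<N v)) w (ew , wr)
      (λ r' (er' , r'r) mx → k r' er' r'r (marks' r' r'r mx)))
    where
    marks' : ∀ r' → p r' < p r → (∀ z → f z ≡ true × p z < p r → p z ≤ p r') → MarksFrom (λ w → q w ∨ isEq w r') r'
    marks' r' r'r mx w ew r'w with <-cmp (p w) (p r)
    ... | tri< l _ _ = ∨-introʳ (q w) (isEq-p (≤-antisym (mx w (ew , l)) r'w))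
    ... | tri≈ _ eq _ = ∨-introˡ _ (marks w ew (≤-reflexive (esym eq)))
    ... | tri> _ _ g = ∨-introˡ _ (marks w ew (<⇒≤ g))

  add-one : ∀ q a k → count q ≤ k → count (λ w → q w ∨ isEq w a) ≤ suc k
  add-one q a k h = ≤-trans (count-∨ {n} q (λ w → isEq w a))
    (subst (λ t → count q + t ≤ suc k) (esym (count-single a)) (subst (_≤ suc k) (+-comm 1 (count q)) (s≤s h)))

  withLast : ((r5 : Fin n) → f r5 ≡ true → (∀ w → f w ≡ true → p w ≤ p r5) → ⊥) → ⊥
  withLast k = some-value (λ w ew → withMaximal (λ v → f v ≡ true) p N (λ v _ → <⇒≤ (p<N v)) w ew k)
    where
    some-value : ((w : Fin n) → f w ≡ true → ⊥) → ⊥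
    some-value h with () ← subst (5 ≤_) (count-zero {n} f (λ w → false-of-¬true (h w))) five

  withFive : ((r1 r2 r3 r4 r5 : Fin n) → f r1 ≡ true → f r2 ≡ true → f r3 ≡ true → f r4 ≡ true → f r5 ≡ true →
              p r1 < p r2 → p r2 < p r3 → p r3 < p r4 → p r4 < p r5 → ⊥) → ⊥
  withFive k = withLast λ r5 e5 mx5 →
    stepDown (λ w → isEq w r5) r5 (≤-trans (≤-reflexive (count-single r5)) (s≤s z≤n)) (marks5 r5 mx5) λ r4 e4 l4 m4 →
    stepDown _ r4 (≤-trans (add-one _ r4 1 (≤-reflexive (count-single r5))) (s≤s (s≤s z≤n))) m4 λ r3 e3 l3 m3 →
    stepDown _ r3 (≤-trans (add-one _ r3 2 (add-one _ r4 1 (≤-reflexive (count-single r5)))) (s≤s (s≤s (s≤s z≤n)))) m3 λ r2 e2 l2 m2 →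
    stepDown _ r2 (add-one _ r2 3 (add-one _ r3 2 (add-one _ r4 1 (≤-reflexive (count-single r5))))) m2 λ r1 e1 l1 m1 →
    k r1 r2 r3 r4 r5 e1 e2 e3 e4 e5 l1 l2 l3 l4
    where
    marks5 : ∀ r5 → (∀ w → f w ≡ true → p w ≤ p r5) → MarksFrom (λ w → isEq w r5) r5
    marks5 r5 mx w ew le = isEq-p (≤-antisym (mx w ew) le)

-- In a simple block every vertex x whose neighbours all lie in B has degree
-- at most 4.  Put x first and let r1 < … < r5 be neighbours.  The chord x r3
-- separates the inner face of x r2, which lies in [x, r3], from the inner
-- face of x r5, which avoids (x, r3) because the edge x r4 covers it.

module _ {n : ℕ} (G : Graph n) (B : Subset n) (bic : Biconnected G B) where

  inner-degree≤4 : (D : Drawing G B) → ∀ x → x ∈ B → (∀ w → E G x w → w ∈ B) → deg G x ≤ 4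
  inner-degree≤4 D x xB nb = ≮⇒≥ λ five →
    FiveIncreasing.withFive (adj G x) p N p<N injective five separated
    where
    D' = rotateAt G B D (Drawing.p D x)
    open Drawing D'
    open InDrawing G B D' bic

    x-first : ∀ {r} → E G x r → p x < p r
    x-first {r} e = rotated-first G B D x r (λ q → E-≢ G e (esym q))

    separated : ∀ r1 r2 r3 r4 r5 → E G x r1 → E G x r2 → E G x r3 → E G x r4 → E G x r5 →
                p r1 < p r2 → p r2 < p r3 → p r3 < p r4 → p r4 < p r5 → ⊥
    separated r1 r2 r3 r4 r5 e1 e2 e3 e4 e5 l1 l2 l3 l4 =
      chord-separates x r3 (innerFace x r2) (innerFace x r5) xB (nb r3 e3) e3 (x-first e3) A A'
        (λ g h → inner-lower h , ≤-trans (inner-upper h) (<⇒≤ l2))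
        (λ (_ , h) → <-irrefl refl (<-≤-trans l2 (inner-upper h)))
        (λ g h (xg , gr3) → inner-uncovered h (under-xr4 g xg (<-trans gr3 l3)))
        (λ (_ , h) → inner-uncovered h (under-xr4 r3 (x-first e3) l3))
      where
      A = InnerFace.face x r2 xB (nb r2 e2) e2 (x-first e2) r1 (nb r1 e1) (x-first e1) l1
      A' = InnerFace.face x r5 xB (nb r5 e5) e5 (x-first e5) r4 (nb r4 e4) (x-first e4) l4
      under-xr4 : ∀ g → p x < p g → p g < p r4 → Covered x r5 g
      under-xr4 g xg gr4 = x , r4 , xB , nb r4 e4 , e4 , ≤-refl , xg , gr4 , <⇒≤ l4 , λ (_ , q) → <-irrefl (cong p q) l4

module BoundaryWalk {n : ℕ} (G : Graph n) (B : Subset n) (bic : Biconnected G B) (D : Drawing G B)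
                    (c : Fin n) (cB : c ∈ B) (c-first : ∀ v → v ≢ c → Drawing.p D c < Drawing.p D v)
                    (nbr-in-B : ∀ v → v ∈ B → v ≢ c → ∀ w → E G v w → w ∈ B)
                    (K : ℕ) (6≤K : 6 ≤ K) (deg≤K : ∀ v → deg G v ≤ K)
                    (small-absent : ∀ v → v ∈ B → deg G v ≤ 2 → deg² G v ≤ K → ⊥) where
  open Drawing D
  open InDrawing G B D bic

  c≤ : ∀ v → p c ≤ p v
  c≤ v with v ≟ c
  ... | yes refl = ≤-refl
  ... | no ne = <⇒≤ (c-first v ne)

  after-c : ∀ {v} → p c < p v → v ≢ c
  after-c l refl = <-irrefl refl l

  deg≤4 : ∀ v → v ∈ B → v ≢ c → deg G v ≤ 4
  deg≤4 v vB ne = inner-degree≤4 G B bic D v vB (nbr-in-B v vB ne)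

  not-two-nbrs : ∀ v a b {A Bd} → v ∈ B → (∀ w → E G v w → w ≡ a ⊎ w ≡ b) →
                 deg G a ≤ A → deg G b ≤ Bd → A + Bd ≤ 6 → ⊥
  not-two-nbrs v a b vB nbrs da db sum =
    small-absent v vB (deg≤2 G v a b nbrs) (≤-trans (deg²-two-nbrs G v a b nbrs) (≤-trans (+-mono-≤ da db) (≤-trans sum 6≤K)))

  Between : Fin n → Fin n → Set
  Between a b = ∃ λ g → g ∈ B × p a < p g × p g < p b

  NoneBetween : Fin n → Fin n → Set
  NoneBetween a b = ∀ g → g ∈ B → ¬ (p a < p g × p g < p b)

  Succ : Fin n → Fin n → Set
  Succ a b = b ∈ B × p a < p b × NoneBetween a b

  Last : Fin n → Set
  Last z = ∀ g → g ∈ B → ¬ (p z < p g)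

  Chord : Fin n → Fin n → Set
  Chord a b = a ∈ B × b ∈ B × E G a b × p a < p b × Between a b × (∃ λ g → g ∈ B × (p g < p a ⊎ p b < p g))

  chord-edge : ∀ {a b} → Chord a b → E G a b
  chord-edge ch = proj₁ (proj₂ (proj₂ ch))

  succ-no-chord : ∀ {a z} → Succ a z → ¬ Chord a z
  succ-no-chord (_ , _ , none) (_ , _ , _ , _ , (g , gB , b) , _) = none g gB b

  withSucc : ∀ a → (∃ λ g → g ∈ B × p a < p g) → ((b : Fin n) → Succ a b → ⊥) → ⊥
  withSucc a (g , gB , ag) k = withMinimal (λ z → z ∈ B × p a < p z) p g (gB , ag)
    (λ b (bB , ab) mn → k b (bB , ab , λ z zB (az , zb) → <-irrefl refl (<-≤-trans zb (mn z (zB , az)))))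

  succOrLast : ∀ a → ((b : Fin n) → Succ a b → ⊥) → (Last a → ⊥) → ⊥
  succOrLast a k1 k2 = k2 (λ g gB ag → withSucc a (g , gB , ag) k1)

  succ-reaches : ∀ {a b g} → Succ a b → g ∈ B → p a < p g → b ≡ g ⊎ p b < p g
  succ-reaches {a} {b} {g} (bB , ab , none) gB ag with <-cmp (p b) (p g)
  ... | tri< l _ _ = inj₂ l
  ... | tri≈ _ e _ = inj₁ (p-inj e)
  ... | tri> _ _ l = ⊥-elim (none g gB (ag , l))

  succ-unique : ∀ {z b w} → Succ z b → w ∈ B → p z < p w → NoneBetween z w → w ≡ b
  succ-unique {z} {b} {w} (bB , zb , none) wB zw none' with <-cmp (p w) (p b)
  ... | tri< l _ _ = ⊥-elim (none w wB (zw , l))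
  ... | tri≈ _ e _ = p-inj e
  ... | tri> _ _ g = ⊥-elim (none' b bB (zb , g))

  pred-unique : ∀ {a z w} → a ∈ B → Succ a z → w ∈ B → p w < p z → NoneBetween w z → w ≡ a
  pred-unique {a} {z} {w} aB (zB , az , none) wB wz none' with <-cmp (p w) (p a)
  ... | tri< l _ _ = ⊥-elim (none' a aB (l , az))
  ... | tri≈ _ e _ = p-inj e
  ... | tri> _ _ g = ⊥-elim (none w wB (g , wz))

  succ-not-last : ∀ {z b} → Succ z b → Last z → ⊥
  succ-not-last (bB , zb , _) last = last _ bB zb

  succ-adjacent : ∀ {a b} → a ∈ B → Succ a b → E G a b
  succ-adjacent aB (bB , ab , none) = next-adjacent _ _ aB bB ab none

  last-adjacent : ∀ t → t ∈ B → t ≢ c → Last t → E G t c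
  last-adjacent t tB tc last = consecutive-adjacent G B D bic t c tB cB tc nothing-between
    where
    nothing-between : ∀ g → g ∈ B → ¬ Cyclic p t g c
    nothing-between g gB (inj₁ (tg , gc)) = last g gB tg
    nothing-between g gB (inj₂ (inj₁ (gc , ct))) = <-irrefl refl (<-≤-trans gc (c≤ g))
    nothing-between g gB (inj₂ (inj₂ (ct , tg))) = last g gB tg

  data NbrKind (z w : Fin n) : Set where
    forward   : p z < p w → NoneBetween z w → NbrKind z w
    backward  : p w < p z → NoneBetween w z → NbrKind z w
    chordUp   : Chord z w → NbrKind z w
    chordDown : Chord w z → NbrKind z w
    closing   : w ≡ c → Last z → NbrKind z w

  classifyNbr : ∀ z w → z ∈ B → z ≢ c → E G z w → (NbrKind z w → ⊥) → ⊥
  classifyNbr z w zB zc e k with <-cmp (p z) (p w)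
  ... | tri≈ _ q _ = E-≢ G e (p-inj q)
  ... | tri< l _ _ = byCases (λ bt → k (chordUp (zB , wB , e , l , bt , c , cB , inj₁ (c-first z zc))))
                             (λ nb → k (forward l (λ g gB b → nb (g , gB , b))))
    where wB = nbr-in-B z zB zc w e
  ... | tri> _ _ l = byCases below (λ nb → k (backward l (λ g gB b → nb (g , gB , b))))
    where
    wB = nbr-in-B z zB zc w e
    below : Between w z → ⊥
    below bt with w ≟ c
    ... | no wc = k (chordDown (wB , zB , E-sym G e , l , bt , c , cB , inj₁ (c-first w wc)))
    ... | yes refl = byCases (λ (g , gB , zg) → k (chordDown (wB , zB , E-sym G e , l , bt , g , gB , inj₂ zg)))
                             (λ nt → k (closing refl (λ g gB zg → nt (g , gB , zg))))

  -- The fan at c: if v has neighbours among a, c and a has neighbours among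
  -- d, v, c, where ca and cd are edges, then v sees only c's closed
  -- neighbourhood and deg² v ≤ K.
  fan-at-c : ∀ v a d → (∀ w → E G v w → w ≡ a ⊎ w ≡ c) → (∀ w → E G a w → w ≡ d ⊎ w ≡ v ⊎ w ≡ c) →
             E G c a → E G c d → deg² G v ≤ K
  fan-at-c v a d Nv Na eca ecd with adj G v c in e
  ... | true = ≤-trans (deg²-fan G v c (E-sym G e) in-closed-nbhd) (deg≤K c)
    where
    in-closed-nbhd : ∀ j w → v ≢ j → E G v w → (j ≡ w ⊎ E G w j) → j ≡ c ⊎ E G c j
    in-closed-nbhd j w ne ew r with Nv w ew
    in-closed-nbhd j w ne ew (inj₁ refl) | inj₁ refl = inj₂ eca
    in-closed-nbhd j w ne ew (inj₂ ej) | inj₁ refl with Na j ej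
    ... | inj₁ refl = inj₂ ecd
    ... | inj₂ (inj₁ refl) = ⊥-elim (ne refl)
    ... | inj₂ (inj₂ q) = inj₁ q
    in-closed-nbhd j w ne ew (inj₁ q) | inj₂ refl = inj₁ q
    in-closed-nbhd j w ne ew (inj₂ ej) | inj₂ refl = inj₂ ej
  ... | false = ≤-trans (deg²-one-nbr G v a only-a) (deg≤K a)
    where
    only-a : ∀ w → E G v w → w ≡ a
    only-a w ew with Nv w ew
    ... | inj₁ q = q
    ... | inj₂ refl with () ← trans (esym e) ew

  -- Case 1: a chord xy with x ≠ c; take one of least span.  A vertex
  -- strictly inside (x, y) has only its predecessor and successor as
  -- neighbours (a chord from it would cross xy or be shorter), so the walk
  -- u1 < u2 < … from x towards y runs through vertices of degree 2, and the
  -- first or second of them is excluded.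
  module ChordAwayFromC where
    ChordAway : Fin n × Fin n → Set
    ChordAway (a , b) = Chord a b × a ≢ c

    span : Fin n × Fin n → ℕ
    span (a , b) = p b ∸ p a

    module Innermost (x y : Fin n) (ch : Chord x y) (xc : x ≢ c)
                     (least : ∀ q → ChordAway q → span (x , y) ≤ span q) where
      xB = proj₁ ch
      yB = proj₁ (proj₂ ch)
      exy = chord-edge ch
      xy = proj₁ (proj₂ (proj₂ (proj₂ ch)))

      yc : y ≢ c
      yc = after-c (≤-<-trans (c≤ x) xy)

      not-shorter : ∀ a b → Chord a b → a ≢ c → p b ∸ p a < p y ∸ p x → ⊥
      not-shorter a b ch' ac lt = <-irrefl refl (<-≤-trans lt (least (a , b) (ch' , ac)))

      interior-nbr : ∀ z w → z ∈ B → p x < p z → p z < p y → E G z w →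
                     ((p z < p w × NoneBetween z w) ⊎ (p w < p z × NoneBetween w z) → ⊥) → ⊥
      interior-nbr z w zB xz zy e k = classifyNbr z w zB zc e kind
        where
        zc : z ≢ c
        zc = after-c (≤-<-trans (c≤ x) xz)
        kind : NbrKind z w → ⊥
        kind (forward l none) = k (inj₁ (l , none))
        kind (backward l none) = k (inj₂ (l , none))
        kind (closing _ last) = last y yB zy
        kind (chordUp ch') with <-cmp (p w) (p y)
        ... | tri> _ _ yw = noCross x y z w exy e (xz , zy , yw)
        ... | tri≈ _ q _ = not-shorter z w ch' zc (subst (λ t → t ∸ p z < p y ∸ p x) (esym q) (∸-monoʳ-< xz (<⇒≤ zy)))
        ... | tri< wy _ _ = not-shorter z w ch' zc (≤-<-trans (∸-monoˡ-≤ (p z) (<⇒≤ wy)) (∸-monoʳ-< xz (<⇒≤ zy)))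
        kind (chordDown ch') with <-cmp (p w) (p x)
        ... | tri< wx _ _ = noCross w z x y (chord-edge ch') exy (wx , xz , zy)
        ... | tri≈ _ q _ = not-shorter w z ch' (λ wc → xc (trans (esym (p-inj q)) wc))
                             (subst (λ t → p z ∸ t < p y ∸ p x) (esym q) (∸-monoˡ-< zy (<⇒≤ xz)))
        ... | tri> _ _ xw = not-shorter w z ch' (after-c (≤-<-trans (c≤ x) xw))
                             (≤-<-trans (∸-monoʳ-≤ (p z) (<⇒≤ xw)) (∸-monoˡ-< zy (<⇒≤ xz)))

      interior-nbrs : ∀ a z b → a ∈ B → Succ a z → Succ z b → p x < p z → p z < p y →
                      ∀ w → E G z w → w ≡ a ⊎ w ≡ b
      interior-nbrs a z b aB saz szb xz zy w e = stable₂ λ ne → interior-nbr z w (proj₁ saz) xz zy e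
        (λ { (inj₁ (l , none)) → ne (inj₂ (succ-unique szb wB l none))
           ; (inj₂ (l , none)) → ne (inj₁ (pred-unique aB saz wB l none)) })
        where wB = nbr-in-B z (proj₁ saz) (after-c (≤-<-trans (c≤ x) xz)) w e

      -- x u1 y: u1 sees x and y, of degree ≤ 4 each.
      one-inside : ∀ u1 → Succ x u1 → Succ u1 y → ⊥
      one-inside u1 s1 s2 = small-absent u1 (proj₁ s1) (deg≤2 G u1 x y nbrs)
        (≤-trans (deg²-adjacent-nbrs G u1 x y nbrs exy (deg≤4 x xB xc) (deg≤4 y yB yc) (m≤m+n 4 2) (m≤m+n 4 2) ≤-refl) 6≤K)
        where nbrs = interior-nbrs x u1 y xB s1 s2 (proj₁ (proj₂ s1)) (proj₁ (proj₂ s2))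

      -- x u1 u2 y: u1 sees x and u2, of degree ≤ 4 and ≤ 2.
      two-inside : ∀ u1 u2 → Succ x u1 → Succ u1 u2 → Succ u2 y → ⊥
      two-inside u1 u2 s1 s2 s3 = not-two-nbrs u1 x u2 (proj₁ s1) nbrs₁ (deg≤4 x xB xc) (deg≤2 G u2 u1 y nbrs₂) ≤-refl
        where
        xu1 = proj₁ (proj₂ s1)
        xu2 = <-trans xu1 (proj₁ (proj₂ s2))
        nbrs₁ = interior-nbrs x u1 u2 xB s1 s2 xu1 (<-trans (proj₁ (proj₂ s2)) (proj₁ (proj₂ s3)))
        nbrs₂ = interior-nbrs u1 u2 y (proj₁ s1) s2 s3 xu2 (proj₁ (proj₂ s3))

      -- x u1 u2 u3 u4 with u3 before y: u2 sees u1 and u3, of degree ≤ 2 each.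
      three-inside : ∀ u1 u2 u3 u4 → Succ x u1 → Succ u1 u2 → Succ u2 u3 → Succ u3 u4 → p u3 < p y → ⊥
      three-inside u1 u2 u3 u4 s1 s2 s3 s4 u3y =
        not-two-nbrs u2 u1 u3 (proj₁ s2) nbrs₂ (deg≤2 G u1 x u2 nbrs₁) (deg≤2 G u3 u2 u4 nbrs₃) (m≤m+n 4 2)
        where
        xu1 = proj₁ (proj₂ s1)
        xu2 = <-trans xu1 (proj₁ (proj₂ s2))
        xu3 = <-trans xu2 (proj₁ (proj₂ s3))
        u2y = <-trans (proj₁ (proj₂ s3)) u3y
        nbrs₁ = interior-nbrs x u1 u2 xB s1 s2 xu1 (<-trans (proj₁ (proj₂ s2)) u2y)
        nbrs₂ = interior-nbrs u1 u2 u3 (proj₁ s1) s2 s3 xu2 u2y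
        nbrs₃ = interior-nbrs u2 u3 u4 (proj₁ s2) s3 s4 xu3 u3y

      contradiction : ⊥
      contradiction with proj₁ (proj₂ (proj₂ (proj₂ (proj₂ ch))))
      ... | (g , gB , xg , gy) = withSucc x (g , gB , xg) λ u1 s1 →
        withSucc u1 (y , yB , u1<y s1) λ u2 s2 → after-u2 u1 u2 s1 s2 (succ-reaches s2 yB (u1<y s1))
        where
        u1<y : ∀ {u1} → Succ x u1 → p u1 < p y
        u1<y s1 with succ-reaches s1 gB xg
        ... | inj₁ refl = gy
        ... | inj₂ l = <-trans l gy
        after-u3 : ∀ u1 u2 u3 → Succ x u1 → Succ u1 u2 → Succ u2 u3 → u3 ≡ y ⊎ p u3 < p y → ⊥
        after-u3 u1 u2 u3 s1 s2 s3 (inj₁ refl) = two-inside u1 u2 s1 s2 s3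
        after-u3 u1 u2 u3 s1 s2 s3 (inj₂ u3y) =
          withSucc u3 (y , yB , u3y) λ u4 s4 → three-inside u1 u2 u3 u4 s1 s2 s3 s4 u3y
        after-u2 : ∀ u1 u2 → Succ x u1 → Succ u1 u2 → u2 ≡ y ⊎ p u2 < p y → ⊥
        after-u2 u1 u2 s1 s2 (inj₁ refl) = one-inside u1 s1 s2
        after-u2 u1 u2 s1 s2 (inj₂ u2y) =
          withSucc u2 (y , yB , u2y) λ u3 s3 → after-u3 u1 u2 u3 s1 s2 s3 (succ-reaches s3 yB u2y)

    no-chord-away : ∀ a b → Chord a b → a ≢ c → ⊥
    no-chord-away a b ch ac = withMinimal ChordAway span (a , b) (ch , ac)
      (λ { (x , y) (ch' , xc) least → Innermost.contradiction x y ch' xc least })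

  -- Case 2: every chord starts at c.  Walk b1 < b2 < … from c.  Vertices
  -- not hit by a chord have degree 2, those hit by one have degree ≤ 3
  -- (their third neighbour is c); the first chords from c decide which
  -- vertex near c is excluded.  Two chords from c beyond b2 are impossible:
  -- the inner faces of c b2 and of c t (t the last vertex) would be
  -- separated by the first of them.
  module ChordsFromC (all-at-c : ∀ a b → Chord a b → a ≡ c) where

    nbrs-plain : ∀ a z b → a ∈ B → Succ a z → Succ z b → z ≢ c → ¬ Chord c z → ∀ w → E G z w → w ≡ a ⊎ w ≡ b
    nbrs-plain a z b aB saz szb zc nch w e = stable₂ λ ne → classifyNbr z w (proj₁ saz) zc e (kind ne)
      where
      wB = nbr-in-B z (proj₁ saz) zc w e
      kind : ¬ (w ≡ a ⊎ w ≡ b) → NbrKind z w → ⊥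
      kind ne (forward l none) = ne (inj₂ (succ-unique szb wB l none))
      kind ne (backward l none) = ne (inj₁ (pred-unique aB saz wB l none))
      kind ne (chordUp ch) = zc (all-at-c z w ch)
      kind ne (chordDown ch) with all-at-c w z ch
      ... | refl = nch ch
      kind ne (closing _ last) = succ-not-last szb last

    nbrs-with-c : ∀ a z b → a ∈ B → Succ a z → Succ z b → z ≢ c → ∀ w → E G z w → w ≡ a ⊎ w ≡ b ⊎ w ≡ c
    nbrs-with-c a z b aB saz szb zc w e = stable₃ λ ne → classifyNbr z w (proj₁ saz) zc e (kind ne)
      where
      wB = nbr-in-B z (proj₁ saz) zc w e
      kind : ¬ (w ≡ a ⊎ w ≡ b ⊎ w ≡ c) → NbrKind z w → ⊥
      kind ne (forward l none) = ne (inj₂ (inj₁ (succ-unique szb wB l none)))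
      kind ne (backward l none) = ne (inj₁ (pred-unique aB saz wB l none))
      kind ne (chordUp ch) = zc (all-at-c z w ch)
      kind ne (chordDown ch) = ne (inj₂ (inj₂ (all-at-c w z ch)))
      kind ne (closing q _) = ne (inj₂ (inj₂ q))

    nbrs-last : ∀ a z → a ∈ B → Succ a z → Last z → z ≢ c → ∀ w → E G z w → w ≡ a ⊎ w ≡ c
    nbrs-last a z aB saz last zc w e = stable₂ λ ne → classifyNbr z w (proj₁ saz) zc e (kind ne)
      where
      wB = nbr-in-B z (proj₁ saz) zc w e
      kind : ¬ (w ≡ a ⊎ w ≡ c) → NbrKind z w → ⊥
      kind ne (forward l none) = last w wB l
      kind ne (backward l none) = ne (inj₁ (pred-unique aB saz wB l none))
      kind ne (chordUp (_ , _ , _ , zw , _)) = last w wB zw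
      kind ne (chordDown ch) = ne (inj₂ (all-at-c w z ch))
      kind ne (closing q _) = ne (inj₂ q)

    deg≤2-plain : ∀ a z → a ∈ B → Succ a z → z ≢ c → ¬ Chord c z → deg G z ≤ 2
    deg≤2-plain a z aB saz zc nch = ≮⇒≥ λ lt → succOrLast z
      (λ b szb → <⇒≱ lt (deg≤2 G z a b (nbrs-plain a z b aB saz szb zc nch)))
      (λ last → <⇒≱ lt (deg≤2 G z a c (nbrs-last a z aB saz last zc)))

    deg≤3-any : ∀ a z → a ∈ B → Succ a z → z ≢ c → deg G z ≤ 3
    deg≤3-any a z aB saz zc = ≮⇒≥ λ lt → succOrLast z
      (λ b szb → <⇒≱ lt (deg≤3 G z a b c (nbrs-with-c a z b aB saz szb zc)))
      (λ last → <⇒≱ lt (≤-trans (deg≤2 G z a c (nbrs-last a z aB saz last zc)) (n≤1+n 2)))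

    beyond-chord : ∀ {q} → Chord c q → ∃ λ g → g ∈ B × p q < p g
    beyond-chord (_ , _ , _ , _ , _ , g , gB , inj₁ gc) = ⊥-elim (<-irrefl refl (<-≤-trans gc (c≤ g)))
    beyond-chord (_ , _ , _ , _ , _ , g , gB , inj₂ qg) = g , gB , qg

    module FromB1 (b1 : Fin n) (s1 : Succ c b1) where
      b1B = proj₁ s1
      cb1 = proj₁ (proj₂ s1)
      b1c = after-c cb1
      ecb1 = succ-adjacent cB s1

      -- B = {c, b1}: b1 has degree 1.
      b1-last : Last b1 → ⊥
      b1-last last = small-absent b1 b1B (≤-trans (deg≤1 G b1 c only-c) (s≤s z≤n)) (≤-trans (deg²-one-nbr G b1 c only-c) (deg≤K c))
        where
        only-c : ∀ w → E G b1 w → w ≡ c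
        only-c w e with nbrs-last c b1 cB s1 last b1c w e
        ... | inj₁ q = q
        ... | inj₂ q = q

      module FromB2 (b2 : Fin n) (s2 : Succ b1 b2) where
        b2B = proj₁ s2
        b1b2 = proj₁ (proj₂ s2)
        cb2 = <-trans cb1 b1b2
        b2c = after-c cb2
        N1 : ∀ w → E G b1 w → w ≡ c ⊎ w ≡ b2
        N1 = nbrs-plain c b1 b2 cB s1 s2 b1c (succ-no-chord s1)
        d1 : deg G b1 ≤ 2
        d1 = deg≤2 G b1 c b2 N1

        -- No chord at all: b1 (if b2 is last, via the triangle c b1 b2) or
        -- b2 (between two vertices of degree 2) is excluded.
        no-chords : ¬ (∃ λ q → Chord c q) → ⊥
        no-chords nq = succOrLast b2 with-b3 b2-last
          where
          b2-last : Last b2 → ⊥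
          b2-last last = small-absent b1 b1B d1
            (deg²-adjacent-nbrs G b1 c b2 N1 (E-sym G (last-adjacent b2 b2B b2c last)) (deg≤K c)
               (deg≤2 G b2 b1 c (nbrs-last b1 b2 b1B s2 last b2c)) ≤-refl (≤-trans (m≤m+n 2 4) 6≤K) ≤-refl)
          with-b3 : ∀ b3 → Succ b2 b3 → ⊥
          with-b3 b3 s3 = not-two-nbrs b2 b1 b3 b2B (nbrs-plain b1 b2 b3 b1B s2 s3 b2c (λ ch → nq (b2 , ch))) d1
            (deg≤2-plain b2 b3 b2B s3 (after-c (<-trans cb2 (proj₁ (proj₂ s3)))) (λ ch → nq (b3 , ch))) (m≤m+n 4 2)

        module SecondChord (ch2 : Chord c b2) (q2 : Fin n) (chq2 : Chord c q2) (b2q2 : p b2 < p q2)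
                           (nq3 : ¬ (∃ λ q → Chord c q × p q2 < p q)) where
          q2B = proj₁ (proj₂ chq2)
          q2c = after-c (<-trans cb2 b2q2)
          d2 = deg≤3-any b1 b2 b1B s2 b2c

          -- b2 b3 b4 with b3 < q2: b3 sees b2 and b4, of degree ≤ 3 each.
          before-q2 : (∀ z → Chord c z → p b2 < p z → p q2 ≤ p z) → ∀ b3 b4 → Succ b2 b3 → Succ b3 b4 → p b3 < p q2 → ⊥
          before-q2 least2 b3 b4 s3 s4 b3q = not-two-nbrs b3 b2 b4 (proj₁ s3) N3 d2
            (deg≤3-any b3 b4 (proj₁ s3) s4 (after-c (<-trans cb2 (<-trans b2b3 (proj₁ (proj₂ s4)))))) ≤-refl
            where
            b2b3 = proj₁ (proj₂ s3)
            N3 = nbrs-plain b2 b3 b4 b2B s3 s4 (after-c (<-trans cb2 b2b3))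
                   (λ ch → <-irrefl refl (<-≤-trans b3q (least2 b3 ch b2b3)))

          -- b2 q2 b4: b4 sees q2 and either its plain successor or c (fan).
          at-q2 : Succ b2 q2 → ∀ b4 → Succ q2 b4 → ⊥
          at-q2 s3 b4 s4 = succOrLast b4 with-b5 b4-last
            where
            q2b4 = proj₁ (proj₂ s4)
            b4c = after-c (<-trans cb2 (<-trans b2q2 q2b4))
            N3 = nbrs-with-c b2 q2 b4 b2B s3 s4 q2c
            with-b5 : ∀ b5 → Succ b4 b5 → ⊥
            with-b5 b5 s5 = not-two-nbrs b4 q2 b5 (proj₁ s4)
              (nbrs-plain q2 b4 b5 q2B s4 s5 b4c (λ ch → nq3 (b4 , ch , q2b4))) (deg≤3-any b2 q2 b2B s3 q2c)
              (deg≤2-plain b4 b5 (proj₁ s4) s5 (after-c (<-trans cb2 (<-trans b2q2 q2b5))) (λ ch → nq3 (b5 , ch , q2b5)))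
              (m≤m+n 5 1)
              where q2b5 = <-trans q2b4 (proj₁ (proj₂ s5))
            b4-last : Last b4 → ⊥
            b4-last last = small-absent b4 (proj₁ s4) (deg≤2 G b4 q2 c N4)
              (fan-at-c b4 q2 b2 N4 N3 (chord-edge chq2) (chord-edge ch2))
              where N4 = nbrs-last q2 b4 q2B s4 last b4c

          walk : (∀ z → Chord c z → p b2 < p z → p q2 ≤ p z) → ⊥
          walk least2 = withSucc b2 (q2 , q2B , b2q2) λ b3 s3 → reach-q2 b3 s3 (succ-reaches s3 q2B b2q2)
            where
            reach-q2 : ∀ b3 → Succ b2 b3 → b3 ≡ q2 ⊎ p b3 < p q2 → ⊥
            reach-q2 b3 s3 (inj₁ refl) = withSucc q2 (beyond-chord chq2) (at-q2 s3)
            reach-q2 b3 s3 (inj₂ b3q) = withSucc b3 (q2 , q2B , b3q) λ b4 s4 → before-q2 least2 b3 b4 s3 s4 b3q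

        -- A third chord c q3 with q3 > q2: the chord c q2 separates the inner
        -- face of c b2 from the inner face of c t, t the last vertex.
        three-chords : Chord c b2 → ∀ q2 q3 → Chord c q2 → p b2 < p q2 → Chord c q3 → p q2 < p q3 → ⊥
        three-chords ch2 q2 q3 chq2 b2q2 chq3 q2q3 = withMaximal (_∈ B) p N (λ v _ → <⇒≤ (p<N v)) c cB λ t tB mx →
          let last : Last t
              last g gB tg = <-irrefl refl (<-≤-trans tg (mx g gB))
              q3t : p q3 < p t
              q3t = let (g , gB , q3g) = beyond-chord chq3 in <-≤-trans q3g (mx g gB)
              b2t = <-trans b2q2 (<-trans q2q3 q3t)
              ect = E-sym G (last-adjacent t tB (after-c (<-trans cb2 b2t)) last)
              A = InnerFace.face c b2 cB b2B (chord-edge ch2) cb2 b1 b1B cb1 b1b2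
              A' = InnerFace.face c t cB tB ect (<-trans cb2 b2t) b1 b1B cb1 (<-trans b1b2 b2t)
              under-cq3 : ∀ g → p c < p g → p g < p q3 → Covered c t g
              under-cq3 g cg gq3 = c , q3 , cB , proj₁ (proj₂ chq3) , chord-edge chq3 , ≤-refl , cg , gq3 , <⇒≤ q3t ,
                                   λ (_ , e) → <-irrefl (cong p e) q3t
          in chord-separates c q2 (innerFace c b2) (innerFace c t) cB (proj₁ (proj₂ chq2)) (chord-edge chq2)
               (<-trans cb2 b2q2) A A'
               (λ g h → inner-lower h , ≤-trans (inner-upper h) (<⇒≤ b2q2))
               (λ (_ , h) → <-irrefl refl (<-≤-trans b2q2 (inner-upper h)))
               (λ g h (cg , gq2) → inner-uncovered h (under-cq3 g cg (<-trans gq2 q2q3)))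
               (λ (_ , h) → inner-uncovered h (under-cq3 q2 (<-trans cb2 b2q2) q2q3))

        chord-to-b2 : Chord c b2 → ⊥
        chord-to-b2 ch2 = byCases later-chord no-later-chord
          where
          d2 = deg≤3-any b1 b2 b1B s2 b2c
          -- No further chord: b3 = succ b2 sees b2 and a plain vertex or c.
          no-later-chord : ¬ (∃ λ q → Chord c q × p b2 < p q) → ⊥
          no-later-chord nq = withSucc b2 (beyond-chord ch2) λ b3 s3 →
            let b2b3 = proj₁ (proj₂ s3)
                b3c = after-c (<-trans cb2 b2b3)
                N2 = nbrs-with-c b1 b2 b3 b1B s2 s3 b2c
            in succOrLast b3
              (λ b4 s4 → let b2b4 = <-trans b2b3 (proj₁ (proj₂ s4)) in
                 not-two-nbrs b3 b2 b4 (proj₁ s3) (nbrs-plain b2 b3 b4 b2B s3 s4 b3c (λ ch → nq (b3 , ch , b2b3))) d2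
                   (deg≤2-plain b3 b4 (proj₁ s3) s4 (after-c (<-trans cb2 b2b4)) (λ ch → nq (b4 , ch , b2b4))) (m≤m+n 5 1))
              (λ last → let N3 = nbrs-last b2 b3 b2B s3 last b3c in
                 small-absent b3 (proj₁ s3) (deg≤2 G b3 b2 c N3) (fan-at-c b3 b2 b1 N3 N2 (chord-edge ch2) ecb1))
          later-chord : (∃ λ q → Chord c q × p b2 < p q) → ⊥
          later-chord (q0 , ch0 , b2q0) = withMinimal (λ q → Chord c q × p b2 < p q) p q0 (ch0 , b2q0)
            λ q2 (chq2 , b2q2) least2 →
              byCases (λ (q3 , chq3 , q2q3) → three-chords ch2 q2 q3 chq2 b2q2 chq3 q2q3)
                      (λ nq3 → SecondChord.walk ch2 q2 chq2 b2q2 nq3 (λ z chz b2z → least2 z (chz , b2z)))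

        module FirstChord (q1 : Fin n) (ch1 : Chord c q1) (least1 : ∀ z → Chord c z → p q1 ≤ p z) where
          q1B = proj₁ (proj₂ ch1)
          b1q1 : p b1 < p q1
          b1q1 with proj₁ (proj₂ (proj₂ (proj₂ (proj₂ ch1))))
          ... | (g , gB , cg , gq) with succ-reaches s1 gB cg
          ...   | inj₁ refl = gq
          ...   | inj₂ l = <-trans l gq
          below-q1 : ∀ z → p z < p q1 → ¬ Chord c z
          below-q1 z l ch = <-irrefl refl (<-≤-trans l (least1 z ch))

          -- b2 < q1: b2 sees b1 and b3 where b3 = q1 (degree ≤ 4) or is plain.
          before-q1 : p b2 < p q1 → ⊥
          before-q1 b2q = withSucc b2 (q1 , q1B , b2q) λ b3 s3 → reach-q1 b3 s3 (succ-reaches s3 q1B b2q)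
            where
            N2 : ∀ {b3} → Succ b2 b3 → ∀ w → E G b2 w → w ≡ b1 ⊎ w ≡ b3
            N2 s3 = nbrs-plain b1 b2 _ b1B s2 s3 b2c (below-q1 b2 b2q)
            reach-q1 : ∀ b3 → Succ b2 b3 → b3 ≡ q1 ⊎ p b3 < p q1 → ⊥
            reach-q1 b3 s3 (inj₁ refl) =
              not-two-nbrs b2 b1 q1 b2B (N2 s3) d1 (deg≤4 q1 q1B (after-c (<-trans cb1 b1q1))) ≤-refl
            reach-q1 b3 s3 (inj₂ b3q) = withSucc b3 (q1 , q1B , b3q) λ b4 s4 →
              not-two-nbrs b2 b1 b3 b2B (N2 s3) d1
                (deg≤2 G b3 b2 b4 (nbrs-plain b2 b3 b4 b2B s3 s4 (after-c (<-trans cb2 (proj₁ (proj₂ s3)))) (below-q1 b3 b3q)))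
                (m≤m+n 4 2)

          contradiction : ⊥
          contradiction with succ-reaches s2 q1B b1q1
          ... | inj₁ refl = chord-to-b2 ch1
          ... | inj₂ b2q = before-q1 b2q

        contradiction : ⊥
        contradiction = byCases (λ (q0 , ch0) → withMinimal (Chord c) p q0 ch0 FirstChord.contradiction) no-chords

      contradiction : ⊥
      contradiction = succOrLast b1 FromB2.contradiction b1-last

  no-other-vertex : (∃ λ u → u ∈ B × u ≢ c) → ⊥
  no-other-vertex (u , uB , uc) =
    byCases (λ (a , b , ch , ac) → ChordAwayFromC.no-chord-away a b ch ac)
            (λ none → withSucc c (u , uB , c-first u uc)
                        (FromB1.contradiction (λ a b ch → stable₁ (λ ac → none (a , b , ch , ac)))))
    where open ChordsFromC

embeddingDrawing : ∀ {n} (G : Graph n) (pos : Fin n → Fin n) (B : Subset n) →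
                   OuterplanarEmbedding G pos → SimpleBlock G pos B → Drawing G B
embeddingDrawing {n} G pos B emb simp = record
  { p = λ v → toℕ (pos v)
  ; N = n
  ; p<N = λ v → toℕ<n (pos v)
  ; injective = λ x y e → proj₁ emb x y (toℕ-injective e)
  ; noCross = proj₂ emb
  ; simple = simp
  }

isolated-small : ∀ {n} (G : Graph n) K c → (∀ w → ¬ E G c w) → deg G c ≤ 2 × deg² G c ≤ K
isolated-small G K c isolated =
  subst (_≤ 2) (esym (count-zero (adj G c) (λ w → false-of-¬true (isolated w)))) z≤n ,
  subst (_≤ K) (esym (count-zero (adj² G c) (λ j → false-of-¬true (λ h →
    let (_ , w , e , _) = adj²-witness G c j h in isolated w e)))) z≤n

module _ {n : ℕ} (G : Graph n) (B : Subset n) (blk : Block G B) where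

  -- In a block with the single vertex c, c has no neighbour (an edge at c
  -- would extend the block).
  single-vertex-isolated : ∀ c → (∀ u → u ∈ B → u ≡ c) → ∀ w → ¬ E G c w
  single-vertex-isolated c only-c w e = E-≢ G e (esym (only-c w w∈B))
    where
    w∈B : w ∈ B
    w∈B = proj₂ blk (pair G c w) (λ {u} uB → subst (_∈ pair G c w) (esym (only-c u uB)) (pair-left G c w))
                    (edge-biconnected G c w e) (pair-right G c w)

-- Let c be the cutvertex in B, or any vertex of B if
-- there is none; if B ≠ {c}, rotate c to the front and walk the boundary,
-- otherwise c is isolated.
kVertex-in-leaf-block : ∀ {n} (G : Graph n) (pos : Fin n → Fin n) (B : Subset n) (K : ℕ) →
                        OuterplanarEmbedding G pos → LeafBlock G B → SimpleBlock G pos B →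
                        6 ≤ K → (∀ v → deg G v ≤ K) → ∃ λ v → v ∈ B × KVertex G K v
kVertex-in-leaf-block {n} G pos B K emb (blk , leaf) simp 6≤K deg≤K
  with any? (λ v → (v ∈? B) ×-dec ((deg G v ≤? 2) ×-dec (deg² G v ≤? K)))
... | yes found = found
... | no absent = ⊥-elim (byCases (λ (u , uB , cut-u) → centredAt u uB (λ v vB cut-v → leaf v u vB uB cut-v cut-u))
                                  (λ none → centredAt v₀ v₀∈B (λ v vB cut-v → ⊥-elim (none (v , vB , cut-v)))))
  where
  bic = proj₁ blk
  v₀ = proj₁ (proj₁ bic)
  v₀∈B = proj₂ (proj₁ bic)
  D₀ = embeddingDrawing G pos B emb simp
  small-absent : ∀ v → v ∈ B → deg G v ≤ 2 → deg² G v ≤ K → ⊥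
  small-absent v vB d d² = absent (v , vB , d , d²)
  centredAt : ∀ c → c ∈ B → (∀ v → v ∈ B → Cutvertex G v → v ≡ c) → ⊥
  centredAt c cB cut-only-c = byCases
    (BoundaryWalk.no-other-vertex G B bic (rotateAt G B D₀ (Drawing.p D₀ c)) c cB
       (λ v ne → rotated-first G B D₀ c v ne) (λ v vB vc w e → nbr-in-block G B c blk cut-only-c v w vB vc e)
       K 6≤K deg≤K small-absent)
    (λ single → let (d , d²) = isolated-small G K c (single-vertex-isolated G B blk c
                                 (λ u uB → stable₁ (λ uc → single (u , uB , uc))))
                in small-absent c cB d d²)

lemma3p3 : ∀ {n} (G : Graph n) (pos : Fin n → Fin n) (Δ : ℕ) (B : Subset n)
    → OuterplanarEmbedding G pos
    → MaxDegree G Δ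
    → LeafBlock G B
    → SimpleBlock G pos B
    → (5 ≤ Δ → ∃ λ v → v ∈ B × KVertex G (suc Δ) v)
    × (6 ≤ Δ → ∃ λ v → v ∈ B × KVertex G Δ v)
lemma3p3 G pos Δ B emb (deg≤Δ , _) leaf simp =
  (λ 5≤Δ → kVertex-in-leaf-block G pos B (suc Δ) emb leaf simp (s≤s 5≤Δ) (λ v → m≤n⇒m≤1+n (deg≤Δ v))) ,
  (λ 6≤Δ → kVertex-in-leaf-block G pos B Δ emb leaf simp 6≤Δ deg≤Δ)
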